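{- In the setting described in the context, let $L_1,L_2$ be two distinct lines of $S$ and let $\alpha_1\in L_1$, $\alpha_2\in L_2$. Then $\alpha_1$ and $\alpha_2$ are collinear if and only if $\epsilon(\alpha_2)-\epsilon(\alpha_1)=\theta(L_1,L_2)$.
   Context: Let $\Delta$ be the near hexagon $Q(5,2)\otimes Q(5,2)$, i.e. the (up to isomorphism unique) slim dense near hexagon on $243$ points. $Q(5,2)$ is the generalized quadrangle of order $(2,4)$, $W(2)$ that of order $(2,2)$. Known facts fixing notation: any two points of $\Delta$ lie in a unique quad (convex subspace of diameter $2$), which is a $(3\times3)$-grid or a $Q(5,2)$. If $Q$ is a $Q(5,2)$-quad and $x\notin Q$, $x$ is collinear with a unique point $\pi_Q(x)\in Q$; $\pi_Q(x):=x$ for $x\in Q$; $\mathcal{R}_Q(x)$ is the third point of $x\pi_Q(x)$ ($=x$ if $x\in Q$). There are two partitions $T_1,T_2$ of the point set of $\Delta$ into $Q(5,2)$-quads such that every element of $T_1$ meets every element of $T_2$ in a line. Fix distinct $Q,\overline{Q}\in T_1$, put $\overline{\overline{Q}}:=\mathcal{R}_Q(\overline{Q})$, and $S:=\{Q\cap Q_2:Q_2\in T_2\}$ (a spread of $Q$). For $L\in S$ let $R_L\in T_2$ contain $L$. Fix $L^*\in S$, $R^*:=R_{L^*}$. Let $W^0,W^1,W^2$ be the three $W(2)$-subquadrangles of $R^*$ containing the $(3\times 3)$-subgrid $R^*\cap(Q\cup\overline{Q}\cup\overline{\overline{Q}})$ (indexed by $\mathbb{Z}_3$ in a fixed way). For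 $L_1,L_2\in S$, $\theta(L_1,L_2)$ is the unique element of $\mathbb{Z}_3$ with $\pi_{R^*}\circ\pi_{R_{L_2}}\circ\pi_{R_{L_1}}(W^i)=W^{i+\theta(L_1,L_2)}$ for all $i\in\mathbb{Z}_3$. Let $M^*$ be a line of the form $R^*\cap Q_1$ with $Q_1\in T_1\setminus\{Q,\overline{Q},\overline{\overline{Q}}\}$; it meets each $W^i$ in a unique point. For $x\in L^*$ define $\epsilon(x):=i$ if the unique point of $M^*$ collinear with $x$ lies in $W^i$. For $y\in Q\setminus L^*$ define $\epsilon(y):=\epsilon(x)$, where $x$ is the unique point of $L^*$ collinear with $y$. This gives $\epsilon:Q\to\mathbb{Z}_3$. -}

module Defs where

open import Data.Bool using (Bool; true; false; _∧_)
open import Data.Nat using (ℕ; zero; suc; _+_; _<_)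
open import Data.List using (List; []; _∷_; length; filterᵇ)
open import Data.Product using (Σ; Σ-syntax; _×_; _,_; proj₁; ∃!)
open import Data.Sum using (_⊎_)
open import Relation.Binary.PropositionalEquality using (_≡_; _≢_)
open import Relation.Nullary using (¬_)
open import Function.Bundles using (_⇔_)

data F3 : Set where
  f0 f1 f2 : F3

infixl 6 _⊕_ _⊖_
infixl 7 _⊗_

_⊕_ : F3 → F3 → F3
f0 ⊕ y = y
f1 ⊕ f0 = f1
f1 ⊕ f1 = f2
f1 ⊕ f2 = f0
f2 ⊕ f0 = f2
f2 ⊕ f1 = f0
f2 ⊕ f2 = f1

⊝_ : F3 → F3
⊝ f0 = f0
⊝ f1 = f2
⊝ f2 = f1

_⊖_ : F3 → F3 → F3
x ⊖ y = x ⊕ (⊝ y)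

_⊗_ : F3 → F3 → F3
f0 ⊗ y = f0
f1 ⊗ y = y
f2 ⊗ y = ⊝ y

-- An explicit model of the near hexagon Δ = Q(5,2) ⊗ Q(5,2).
--
-- Points: (P , R , a) with P , R ∈ 𝔽₃² and a ∈ 𝔽₃  (3^5 = 243 points).

record Point : Set where
  constructor pt
  field
    p₁ p₂ r₁ r₂ a : F3

-- the four slopes (points of PG(1,3)), i.e. nonzero vectors of 𝔽₃² up to sign
data Slope : Set where
  s10 s01 s11 s12 : Slope

sl₁ : Slope → F3
sl₁ s10 = f1
sl₁ s01 = f0
sl₁ s11 = f1
sl₁ s12 = f1

sl₂ : Slope → F3
sl₂ s10 = f0
sl₂ s01 = f1
sl₂ s11 = f1
sl₂ s12 = f2

ω : F3 → F3 → Slope → F3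
ω x₁ x₂ d = (x₁ ⊗ sl₂ d) ⊖ (x₂ ⊗ sl₁ d)

-- the 9 line directions through a point
data Dir : Set where
  dA : Dir
  dP : Slope → Dir
  dR : Slope → Dir

allDirs : List Dir
allDirs = dA ∷ dP s10 ∷ dP s01 ∷ dP s11 ∷ dP s12
             ∷ dR s10 ∷ dR s01 ∷ dR s11 ∷ dR s12 ∷ []

step : Dir → Point → Point
step dA     (pt p₁ p₂ r₁ r₂ a) = pt p₁ p₂ r₁ r₂ (a ⊕ f1)
step (dP d) (pt p₁ p₂ r₁ r₂ a) =
  pt (p₁ ⊕ sl₁ d) (p₂ ⊕ sl₂ d) r₁ r₂ (a ⊕ ω p₁ p₂ d)
step (dR d) (pt p₁ p₂ r₁ r₂ a) =
  pt p₁ p₂ (r₁ ⊕ sl₁ d) (r₂ ⊕ sl₂ d) (a ⊕ ω r₁ r₂ d)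

-- A line is presented by a point on it and a direction; it consists of
-- the three points  x , step δ x , step δ (step δ x).
Line : Set
Line = Point × Dir

OnLine : Point → Line → Set
OnLine y (x , δ) = y ≡ x ⊎ y ≡ step δ x ⊎ y ≡ step δ (step δ x)

SameLine : Line → Line → Set
SameLine L M = ∀ z → OnLine z L ⇔ OnLine z M

Collinear : Point → Point → Set
Collinear x y = x ≢ y × Σ[ L ∈ Line ] (OnLine x L × OnLine y L)

Subset : Set
Subset = Point → Bool

Pred : Set₁
Pred = Point → Set

infix 4 _∈_ _∉_

_∈_ : Point → Subset → Set
x ∈ X = X x ≡ true

_∉_ : Point → Subset → Set
x ∉ X = ¬ (x ∈ X)

⟦_⟧ : Subset → Pred
⟦ X ⟧ x = x ∈ X

_≐_ : Pred → Pred → Set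
A ≐ B = ∀ z → A z ⇔ B z

lineInᵇ : Subset → Line → Bool
lineInᵇ X (x , δ) = X x ∧ X (step δ x) ∧ X (step δ (step δ x))

LineIn : Line → Subset → Set
LineIn L X = lineInᵇ X L ≡ true

-- number of lines through x that are contained in X
-- (the lines through x are exactly the 9 lines (x , δ), δ ∈ allDirs)
numLinesIn : Subset → Point → ℕ
numLinesIn X x = length (filterᵇ (λ δ → lineInᵇ X (x , δ)) allDirs)

data Within : ℕ → Point → Point → Set where
  here  : ∀ {n x} → Within n x x
  there : ∀ {n x y z} → Collinear x y → Within n y z → Within (suc n) x z

Dist : Point → Point → ℕ → Set
Dist x y n = Within n x y × (∀ m → m < n → ¬ Within m x y)

IsSubspace : Subset → Set
IsSubspace X = ∀ x y (L : Line) → x ≢ y → OnLine x L → OnLine y L →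
               x ∈ X → y ∈ X → ∀ z → OnLine z L → z ∈ X

IsConvex : Subset → Set
IsConvex X = ∀ x y z n m → x ∈ X → y ∈ X →
             Dist x z n → Dist z y m → Dist x y (n + m) → z ∈ X

HasDiameter2 : Subset → Set
HasDiameter2 X = (∀ x y → x ∈ X → y ∈ X → Within 2 x y)
               × Σ[ x ∈ Point ] Σ[ y ∈ Point ] (x ∈ X × y ∈ X × Dist x y 2)

IsQuad : Subset → Set
IsQuad X = IsSubspace X × IsConvex X × HasDiameter2 X

-- X, together with the lines of Δ contained in X, is a generalized
-- quadrangle of order (2 , t)   (lines of Δ have 3 points)
IsGQ : Subset → ℕ → Set
IsGQ X t = (Σ[ x ∈ Point ] x ∈ X)
         × (∀ x → x ∈ X → numLinesIn X x ≡ suc t)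
         × (∀ x (L : Line) → x ∈ X → LineIn L X → ¬ OnLine x L →
              ∃! _≡_ (λ y → OnLine y L × Collinear x y))

IsQ52Quad : Subset → Set
IsQ52Quad X = IsQuad X × IsGQ X 4

IsW2Sub : Subset → Subset → Set
IsW2Sub R X = (∀ x → x ∈ X → x ∈ R) × IsGQ X 2

-- Partitions into Q(5,2)-quads.  A partition T is given by the map
-- blk sending each point to the unique element of T containing it;
-- the elements of T are exactly the sets  blk x.

IsQ52Partition : (Point → Subset) → Set
IsQ52Partition blk =
    (∀ x → x ∈ blk x)
  × (∀ x y → y ∈ blk x → ∀ z → blk y z ≡ blk x z)
  × (∀ x → IsQ52Quad (blk x))

MeetInLine : Subset → Subset → Set
MeetInLine A B = Σ[ L ∈ Line ] (∀ z → (z ∈ A × z ∈ B) ⇔ OnLine z L)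

-- π_Q and 𝓡_Q (as relations; they are functions by the known facts)

IsProj : Subset → Point → Point → Set
IsProj Q x p = (x ∈ Q → p ≡ x) × (x ∉ Q → p ∈ Q × Collinear x p)

IsRefl : Subset → Point → Point → Set
IsRefl Q x r = Σ[ p ∈ Point ] (IsProj Q x p × (x ∈ Q → r ≡ x)
  × (x ∉ Q → r ≢ x × r ≢ p
             × Σ[ L ∈ Line ] (OnLine x L × OnLine p L × OnLine r L)))

record Setting : Set where
  field
    blk₁ blk₂   : Point → Subset
    T₁-part     : IsQ52Partition blk₁
    T₂-part     : IsQ52Partition blk₂
    T₁T₂-meet   : ∀ x y → MeetInLine (blk₁ x) (blk₂ y)
    q q̄         : Point
  Q : Subset
  Q = blk₁ q
  Q̄ : Subset
  Q̄ = blk₁ q̄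
  Q̿ : Pred
  Q̿ y = Σ[ x ∈ Point ] (x ∈ Q̄ × IsRefl Q x y)
  -- L ∈ S  (S = {Q ∩ Q₂ : Q₂ ∈ T₂})
  InS : Line → Set
  InS L = Σ[ y ∈ Point ] (∀ z → OnLine z L ⇔ (z ∈ Q × z ∈ blk₂ y))
  R_ : Line → Subset
  R_ L = blk₂ (proj₁ L)
  field
    Q≢Q̄         : ¬ (⟦ Q ⟧ ≐ ⟦ Q̄ ⟧)
    L*          : Line
    L*∈S        : InS L*
  R* : Subset
  R* = R_ L*
  Grid : Pred
  Grid z = z ∈ R* × (z ∈ Q ⊎ z ∈ Q̄ ⊎ Q̿ z)
  field
    W           : F3 → Subset
    W-W2        : ∀ i → IsW2Sub R* (W i)
    W-grid      : ∀ i z → Grid z → z ∈ W i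
    W-inj       : ∀ i j → i ≢ j → ¬ (⟦ W i ⟧ ≐ ⟦ W j ⟧)
    W-all       : ∀ X → IsW2Sub R* X → (∀ z → Grid z → z ∈ X) →
                  Σ[ i ∈ F3 ] (⟦ X ⟧ ≐ ⟦ W i ⟧)
    m           : Point
    m∈R*        : m ∈ R*
    Q₁≢Q        : ¬ (⟦ blk₁ m ⟧ ≐ ⟦ Q ⟧)
    Q₁≢Q̄        : ¬ (⟦ blk₁ m ⟧ ≐ ⟦ Q̄ ⟧)
    Q₁≢Q̿        : ¬ (⟦ blk₁ m ⟧ ≐ Q̿)
  M* : Pred
  M* z = z ∈ R* × z ∈ blk₁ m
  Img : Line → Line → F3 → Pred
  Img L₁ L₂ i y = Σ[ w ∈ Point ] Σ[ u ∈ Point ] Σ[ v ∈ Point ]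
    (w ∈ W i × IsProj (R_ L₁) w u × IsProj (R_ L₂) u v × IsProj R* v y)
  -- t = θ(L₁ , L₂)  (t is the unique element with this property)
  IsTheta : Line → Line → F3 → Set
  IsTheta L₁ L₂ t = ∀ i → Img L₁ L₂ i ≐ ⟦ W (i ⊕ t) ⟧
  -- e = ε(x) for x ∈ L*
  IsEpsL : Point → F3 → Set
  IsEpsL x e = Σ[ u ∈ Point ] (M* u × Collinear x u × u ∈ W e)
  -- e = ε(y) for y ∈ Q
  IsEps : Point → F3 → Set
  IsEps y e = (OnLine y L* × IsEpsL y e)
            ⊎ (¬ OnLine y L* × Σ[ x ∈ Point ] (OnLine x L* × Collinear y x × IsEpsL x e))

module Submission where

-- Everything is reduced to coordinates.  A *block* is a set of points with
-- fixed P or with fixed R; inside a block the remaining coordinates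
-- (t , a) ∈ 𝔽₃² × 𝔽₃ form a planar model of Q(5,2).
--  1. Two points are collinear iff they lie in a common block and are
--     collinear in its planar model (collinear⇔blockCol); for points of
--     different blocks this is a linear condition on the levels
--     (collinear-across).
--  2. Every Q(5,2)-quad is a block (q52-is-block).  So T₁ and T₂ are the
--     blocks of the two kinds, and the lines of S are determined by two
--     fixed coordinates.
--  3. Projecting between blocks of the same kind keeps t and adds a
--     determinant to the level (proj-emb): π_{R*} ∘ π_{R_{L₂}} ∘ π_{R_{L₁}}
--     shifts the levels of R* by a constant δθ(L₁ , L₂).
--  4. The three W(2)-subquadrangles of R* through the grid are explicit
--     sets C j , j ∈ 𝔽₃ (lift-GQ , C-lines), with W i = C (ρ i) for a
--     permutation ρ of 𝔽₃, and the shift maps C j onto C (j + δθ).  This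
--     computes θ (theta-spec), and ε is read off from levels (ε-formula).
--  5. The lemma becomes an identity in 𝔽₃ (level-algebra , shift-criterion).

open import Defs
open import Data.Bool using (Bool; true; false; _∧_; _∨_)
open import Data.Bool.Properties using (∧-zeroʳ; ∨-zeroʳ)
import Data.Bool as Bool
open import Data.Empty using (⊥; ⊥-elim)
open import Data.List using ([]; _∷_; length; filterᵇ)
open import Data.Nat using (ℕ; zero; suc; _<_; s≤s)
import Data.Nat as ℕ
open import Data.Product using (Σ; _×_; _,_; proj₁; proj₂; ∃!)
open import Data.Product.Properties using (≡-dec)
open import Data.Sum using (_⊎_; inj₁; inj₂)
open import Function.Bundles using (_⇔_; mk⇔; Equivalence)
open import Function.Properties.Equivalence using () renaming (sym to ⇔-sym)
open import Function.Related.Propositional using (module EquationalReasoning)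
open import Relation.Binary.Definitions using (DecidableEquality)
open import Relation.Binary.PropositionalEquality
open import Relation.Nullary using (¬_; Dec; yes; no; does)
open import Relation.Nullary.Decidable
  using (map′; _×-dec_; _⊎-dec_; _→-dec_; ¬?; dec-true; dec-false)
open import Relation.Unary using (Decidable)

-- Used as  decided d refl ; the decision procedures below
-- are built from  ×-dec , ⊎-dec , map′ , so that evaluating  does d  never
-- has to build the proof.
decided : ∀ {A : Set} (d : Dec A) → does d ≡ true → A
decided (yes a) _ = a

infix 4 _≟F_ _≟V_ _≟P_ _≟S_ _≟D_ _≟Pl_

_≟F_ : DecidableEquality F3
f0 ≟F f0 = yes refl
f1 ≟F f1 = yes refl
f2 ≟F f2 = yes refl
f0 ≟F f1 = no λ ()
f0 ≟F f2 = no λ ()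
f1 ≟F f0 = no λ ()
f1 ≟F f2 = no λ ()
f2 ≟F f0 = no λ ()
f2 ≟F f1 = no λ ()

∀F? : {P : F3 → Set} → Decidable P → Dec (∀ x → P x)
∀F? P? = map′ (λ { (p₀ , _ , _) f0 → p₀ ; (_ , p₁ , _) f1 → p₁ ; (_ , _ , p₂) f2 → p₂ })
              (λ h → h f0 , h f1 , h f2) (P? f0 ×-dec P? f1 ×-dec P? f2)

∃F? : {P : F3 → Set} → Decidable P → Dec (Σ F3 P)
∃F? P? = map′ (λ { (inj₁ p) → f0 , p ; (inj₂ (inj₁ p)) → f1 , p ; (inj₂ (inj₂ p)) → f2 , p })
              (λ { (f0 , p) → inj₁ p ; (f1 , p) → inj₂ (inj₁ p) ; (f2 , p) → inj₂ (inj₂ p) })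
              (P? f0 ⊎-dec P? f1 ⊎-dec P? f2)

∀B? : {P : Bool → Set} → Decidable P → Dec (∀ b → P b)
∀B? P? = map′ (λ { (p , q) true → p ; (p , q) false → q }) (λ h → h true , h false)
              (P? true ×-dec P? false)

V2 : Set
V2 = F3 × F3

_≟V_ : DecidableEquality V2
_≟V_ = ≡-dec _≟F_ _≟F_

∀V? : {P : V2 → Set} → Decidable P → Dec (∀ v → P v)
∀V? P? = map′ (λ h v → h (proj₁ v) (proj₂ v)) (λ h a b → h (a , b)) (∀F? λ a → ∀F? λ b → P? (a , b))

_≟P_ : DecidableEquality Point
pt a b c d e ≟P pt a' b' c' d' e' =
  map′ (λ { (refl , refl , refl , refl , refl) → refl }) (λ { refl → refl , refl , refl , refl , refl })
       (a ≟F a' ×-dec b ≟F b' ×-dec c ≟F c' ×-dec d ≟F d' ×-dec e ≟F e')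

∀P? : {P : Point → Set} → Decidable P → Dec (∀ x → P x)
∀P? P? = map′ (λ h → λ { (pt a b c d e) → h a b c d e }) (λ h a b c d e → h (pt a b c d e))
              (∀F? λ a → ∀F? λ b → ∀F? λ c → ∀F? λ d → ∀F? λ e → P? (pt a b c d e))

_≟S_ : DecidableEquality Slope
s10 ≟S s10 = yes refl
s01 ≟S s01 = yes refl
s11 ≟S s11 = yes refl
s12 ≟S s12 = yes refl
s10 ≟S s01 = no λ ()
s10 ≟S s11 = no λ ()
s10 ≟S s12 = no λ ()
s01 ≟S s10 = no λ ()
s01 ≟S s11 = no λ ()
s01 ≟S s12 = no λ ()
s11 ≟S s10 = no λ ()
s11 ≟S s01 = no λ ()
s11 ≟S s12 = no λ ()
s12 ≟S s10 = no λ ()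
s12 ≟S s01 = no λ ()
s12 ≟S s11 = no λ ()

∀S? : {P : Slope → Set} → Decidable P → Dec (∀ s → P s)
∀S? P? = map′ (λ { (p₁ , p₂ , p₃ , p₄) s10 → p₁ ; (p₁ , p₂ , p₃ , p₄) s01 → p₂
                 ; (p₁ , p₂ , p₃ , p₄) s11 → p₃ ; (p₁ , p₂ , p₃ , p₄) s12 → p₄ })
              (λ h → h s10 , h s01 , h s11 , h s12) (P? s10 ×-dec P? s01 ×-dec P? s11 ×-dec P? s12)

∃S? : {P : Slope → Set} → Decidable P → Dec (Σ Slope P)
∃S? P? = map′ (λ { (inj₁ p) → s10 , p ; (inj₂ (inj₁ p)) → s01 , p
                 ; (inj₂ (inj₂ (inj₁ p))) → s11 , p ; (inj₂ (inj₂ (inj₂ p))) → s12 , p })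
              (λ { (s10 , p) → inj₁ p ; (s01 , p) → inj₂ (inj₁ p)
                 ; (s11 , p) → inj₂ (inj₂ (inj₁ p)) ; (s12 , p) → inj₂ (inj₂ (inj₂ p)) })
              (P? s10 ⊎-dec P? s01 ⊎-dec P? s11 ⊎-dec P? s12)

_≟D_ : DecidableEquality Dir
dA   ≟D dA    = yes refl
dP s ≟D dP s' = map′ (cong dP) (λ { refl → refl }) (s ≟S s')
dR s ≟D dR s' = map′ (cong dR) (λ { refl → refl }) (s ≟S s')
dA   ≟D dP _  = no λ ()
dA   ≟D dR _  = no λ ()
dP _ ≟D dA    = no λ ()
dP _ ≟D dR _  = no λ ()
dR _ ≟D dA    = no λ ()
dR _ ≟D dP _  = no λ ()

∀D? : {P : Dir → Set} → Decidable P → Dec (∀ δ → P δ)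
∀D? P? = map′ (λ { (p , q , r) dA → p ; (p , q , r) (dP s) → q s ; (p , q , r) (dR s) → r s })
              (λ h → h dA , (λ s → h (dP s)) , (λ s → h (dR s)))
              (P? dA ×-dec ∀S? (λ s → P? (dP s)) ×-dec ∀S? (λ s → P? (dR s)))

∃D? : {P : Dir → Set} → Decidable P → Dec (Σ Dir P)
∃D? P? = map′ (λ { (inj₁ p) → dA , p ; (inj₂ (inj₁ (s , q))) → dP s , q
                 ; (inj₂ (inj₂ (s , r))) → dR s , r })
              (λ { (dA , p) → inj₁ p ; (dP s , q) → inj₂ (inj₁ (s , q))
                 ; (dR s , r) → inj₂ (inj₂ (s , r)) })
              (P? dA ⊎-dec ∃S? (λ s → P? (dP s)) ⊎-dec ∃S? (λ s → P? (dR s)))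

opaque
  ⊕-assoc : ∀ a b c → (a ⊕ b) ⊕ c ≡ a ⊕ (b ⊕ c)
  ⊕-assoc = decided (∀F? λ a → ∀F? λ b → ∀F? λ c → (a ⊕ b) ⊕ c ≟F a ⊕ (b ⊕ c)) refl

  ⊕-assoc³ : ∀ a b c d → ((a ⊕ b) ⊕ c) ⊕ d ≡ a ⊕ ((b ⊕ c) ⊕ d)
  ⊕-assoc³ = decided (∀F? λ a → ∀F? λ b → ∀F? λ c → ∀F? λ d →
    ((a ⊕ b) ⊕ c) ⊕ d ≟F a ⊕ ((b ⊕ c) ⊕ d)) refl

  ⊕-identityʳ : ∀ a → a ⊕ f0 ≡ a
  ⊕-identityʳ = decided (∀F? λ a → a ⊕ f0 ≟F a) refl

  ⊖-⊕ : ∀ a d → (a ⊖ d) ⊕ d ≡ a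
  ⊖-⊕ = decided (∀F? λ a → ∀F? λ d → (a ⊖ d) ⊕ d ≟F a) refl

  ⊕-⊖ : ∀ a b → a ⊕ (b ⊖ a) ≡ b
  ⊕-⊖ = decided (∀F? λ a → ∀F? λ b → a ⊕ (b ⊖ a) ≟F b) refl

  ⊕-cancelˡ : ∀ a b c → a ⊕ b ≡ a ⊕ c → b ≡ c
  ⊕-cancelˡ = decided (∀F? λ a → ∀F? λ b → ∀F? λ c → a ⊕ b ≟F a ⊕ c →-dec b ≟F c) refl

  ⊕-solve : ∀ a b r → a ≡ b ⊕ r → r ≡ a ⊖ b
  ⊕-solve = decided (∀F? λ a → ∀F? λ b → ∀F? λ r → a ≟F b ⊕ r →-dec r ≟F a ⊖ b) refl

  cover : (a b c : F3) → a ≢ b → a ≢ c → b ≢ c → ∀ i → i ≡ a ⊎ i ≡ b ⊎ i ≡ c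
  cover = decided (∀F? λ a → ∀F? λ b → ∀F? λ c →
    ¬? (a ≟F b) →-dec ¬? (a ≟F c) →-dec ¬? (b ≟F c) →-dec
    ∀F? λ i → i ≟F a ⊎-dec i ≟F b ⊎-dec i ≟F c) refl

table3 : {A : Set} → A → A → A → F3 → A
table3 x y z f0 = x
table3 x y z f1 = y
table3 x y z f2 = z

table3-values : {A : Set} (g : F3 → A) → ∀ i → g i ≡ table3 (g f0) (g f1) (g f2) i
table3-values g f0 = refl
table3-values g f1 = refl
table3-values g f2 = refl

opaque
  injective-affine₃ : ∀ a b c → a ≢ b → a ≢ c → b ≢ c → ∀ t i j →
    table3 a b c (i ⊕ t) ⊖ table3 a b c i ≡ table3 a b c (j ⊕ t) ⊖ table3 a b c j
  injective-affine₃ = decided (∀F? λ a → ∀F? λ b → ∀F? λ c →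
    ¬? (a ≟F b) →-dec ¬? (a ≟F c) →-dec ¬? (b ≟F c) →-dec ∀F? λ t → ∀F? λ i → ∀F? λ j →
    table3 a b c (i ⊕ t) ⊖ table3 a b c i ≟F table3 a b c (j ⊕ t) ⊖ table3 a b c j) refl

-- every permutation of 𝔽₃ is affine: ρ (i + t) − ρ i does not depend on i
injective-affine : ∀ (ρ : F3 → F3) → (∀ i i' → ρ i ≡ ρ i' → i ≡ i') →
                   ∀ t i j → ρ (i ⊕ t) ⊖ ρ i ≡ ρ (j ⊕ t) ⊖ ρ j
injective-affine ρ inj t i j =
  trans (cong₂ _⊖_ (table3-values ρ (i ⊕ t)) (table3-values ρ i))
    (trans (injective-affine₃ (ρ f0) (ρ f1) (ρ f2) (ne (λ ())) (ne (λ ())) (ne (λ ())) t i j)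
           (sym (cong₂ _⊖_ (table3-values ρ (j ⊕ t)) (table3-values ρ j))))
  where
  ne : ∀ {i i'} → i ≢ i' → ρ i ≢ ρ i'
  ne n e = n (inj _ _ e)

shift-criterion : ∀ (ρ : F3 → F3) → (∀ i i' → ρ i ≡ ρ i' → i ≡ i') → ∀ e₁ e₂ d →
                  (∀ i → ρ i ⊕ d ≡ ρ (i ⊕ (e₂ ⊖ e₁))) ⇔ (d ≡ ρ e₂ ⊖ ρ e₁)
shift-criterion ρ inj e₁ e₂ d = mk⇔ to from
  where
  to : (∀ i → ρ i ⊕ d ≡ ρ (i ⊕ (e₂ ⊖ e₁))) → d ≡ ρ e₂ ⊖ ρ e₁
  to h = ⊕-solve (ρ e₂) (ρ e₁) d (sym (trans (h e₁) (cong ρ (⊕-⊖ e₁ e₂))))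
  from : d ≡ ρ e₂ ⊖ ρ e₁ → ∀ i → ρ i ⊕ d ≡ ρ (i ⊕ (e₂ ⊖ e₁))
  from refl i = begin
    ρ i ⊕ (ρ e₂ ⊖ ρ e₁)
      ≡⟨ cong (λ a → ρ i ⊕ (ρ a ⊖ ρ e₁)) (sym (⊕-⊖ e₁ e₂)) ⟩
    ρ i ⊕ (ρ (e₁ ⊕ (e₂ ⊖ e₁)) ⊖ ρ e₁)
      ≡⟨ cong (ρ i ⊕_) (injective-affine ρ inj (e₂ ⊖ e₁) e₁ i) ⟩
    ρ i ⊕ (ρ (i ⊕ (e₂ ⊖ e₁)) ⊖ ρ i)
      ≡⟨ ⊕-⊖ (ρ i) _ ⟩
    ρ (i ⊕ (e₂ ⊖ e₁)) ∎
    where open ≡-Reasoning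

opaque
  level-algebra : ∀ a₁ a₂ x y z k →
    (a₂ ≡ a₁ ⊕ y) ⇔ (((⊝ x) ⊕ y) ⊕ z ≡ ((a₂ ⊕ z) ⊕ k) ⊖ ((a₁ ⊕ x) ⊕ k))
  level-algebra = decided (∀F? λ a₁ → ∀F? λ a₂ → ∀F? λ x → ∀F? λ y → ∀F? λ z → ∀F? λ k →
    let l? = a₂ ≟F a₁ ⊕ y ; r? = ((⊝ x) ⊕ y) ⊕ z ≟F ((a₂ ⊕ z) ⊕ k) ⊖ ((a₁ ⊕ x) ⊕ k) in
    map′ (λ (f , g) → mk⇔ f g) (λ e → Equivalence.to e , Equivalence.from e)
         ((l? →-dec r?) ×-dec (r? →-dec l?))) refl

infixl 6 _+V_

_+V_ : V2 → V2 → V2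
(u₁ , u₂) +V (v₁ , v₂) = u₁ ⊕ v₁ , u₂ ⊕ v₂

negV : V2 → V2
negV (u₁ , u₂) = ⊝ u₁ , ⊝ u₂

-- the symplectic form  det u v = u₁ v₂ − u₂ v₁ ;  ω x₁ x₂ d = det (x₁ , x₂) (slV d)
det : V2 → V2 → F3
det (u₁ , u₂) (v₁ , v₂) = (u₁ ⊗ v₂) ⊖ (u₂ ⊗ v₁)

slV : Slope → V2
slV d = sl₁ d , sl₂ d

slopeOf : V2 → Slope
slopeOf (f0 , f0) = s10
slopeOf (f0 , _)  = s01
slopeOf (_ , f0)  = s10
slopeOf (f1 , f1) = s11
slopeOf (f2 , f2) = s11
slopeOf (f1 , f2) = s12
slopeOf (f2 , f1) = s12

opaque
  +V-comm : ∀ u v → u +V v ≡ v +V u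
  +V-comm = decided (∀V? λ u → ∀V? λ v → u +V v ≟V v +V u) refl

  slope-nonzero : ∀ u s → u +V slV s ≢ u
  slope-nonzero = decided (∀V? λ u → ∀S? λ s → ¬? (u +V slV s ≟V u)) refl

  det-self : ∀ u → det u u ≡ f0
  det-self = decided (∀V? λ u → det u u ≟F f0) refl

  det-anti : ∀ u v → det u v ≡ ⊝ det v u
  det-anti = decided (∀V? λ u → ∀V? λ v → det u v ≟F ⊝ det v u) refl

  zero-sum-third : ∀ x y z → (x +V y) +V z ≡ (f0 , f0) → ∀ i j k → i ≢ j → k ≢ i → k ≢ j →
                   table3 x y z k ≡ negV (table3 x y z i +V table3 x y z j)
  zero-sum-third = decided (∀V? λ x → ∀V? λ y → ∀V? λ z → (x +V y) +V z ≟V (f0 , f0) →-dec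
    ∀F? λ i → ∀F? λ j → ∀F? λ k → ¬? (i ≟F j) →-dec ¬? (k ≟F i) →-dec ¬? (k ≟F j) →-dec
    table3 x y z k ≟V negV (table3 x y z i +V table3 x y z j)) refl

-- A block of kind KR is a set  {z | R z = v}  and a block of
-- kind KP a set  {z | P z = v}; the coordinate a block fixes is  fixed κ ,
-- the other one  moving κ .

data Kind : Set where
  KR KP : Kind

other : Kind → Kind
other KR = KP
other KP = KR

kinds : ∀ κ κ' → κ' ≡ κ ⊎ κ' ≡ other κ
kinds KR KR = inj₁ refl
kinds KR KP = inj₂ refl
kinds KP KR = inj₂ refl
kinds KP KP = inj₁ refl

∀K? : {P : Kind → Set} → Decidable P → Dec (∀ κ → P κ)
∀K? P? = map′ (λ { (p , q) KR → p ; (p , q) KP → q }) (λ h → h KR , h KP) (P? KR ×-dec P? KP)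

∃K? : {P : Kind → Set} → Decidable P → Dec (Σ Kind P)
∃K? P? = map′ (λ { (inj₁ p) → KR , p ; (inj₂ p) → KP , p })
              (λ { (KR , p) → inj₁ p ; (KP , p) → inj₂ p })
              (P? KR ⊎-dec P? KP)

Pc Rc : Point → V2
Pc x = Point.p₁ x , Point.p₂ x
Rc x = Point.r₁ x , Point.r₂ x

level : Point → F3
level = Point.a

fixed moving : Kind → Point → V2
fixed KR = Rc
fixed KP = Pc
moving KR = Pc
moving KP = Rc

Pl : Set
Pl = V2 × F3

planar : Kind → Point → Pl
planar κ x = moving κ x , level x

emb : Kind → V2 → Pl → Point
emb KR (r₁ , r₂) ((p₁ , p₂) , a) = pt p₁ p₂ r₁ r₂ a
emb KP (p₁ , p₂) ((r₁ , r₂) , a) = pt p₁ p₂ r₁ r₂ a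

fixed-emb : ∀ κ v p → fixed κ (emb κ v p) ≡ v
fixed-emb KR v p = refl
fixed-emb KP v p = refl

planar-emb : ∀ κ v p → planar κ (emb κ v p) ≡ p
planar-emb KR v p = refl
planar-emb KP v p = refl

moving-emb : ∀ κ v p → moving κ (emb κ v p) ≡ proj₁ p
moving-emb κ v p = cong proj₁ (planar-emb κ v p)

level-emb : ∀ κ v p → level (emb κ v p) ≡ proj₂ p
level-emb κ v p = cong proj₂ (planar-emb κ v p)

emb-eta : ∀ κ x → emb κ (fixed κ x) (planar κ x) ≡ x
emb-eta KR x = refl
emb-eta KP x = refl

fixed-other : ∀ κ x → fixed (other κ) x ≡ moving κ x
fixed-other KR x = refl
fixed-other KP x = refl

moving-other : ∀ κ x → moving (other κ) x ≡ fixed κ x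
moving-other KR x = refl
moving-other KP x = refl

point-ext : ∀ κ {x y} → fixed κ x ≡ fixed κ y → planar κ x ≡ planar κ y → x ≡ y
point-ext κ {x} {y} ef ep = trans (sym (emb-eta κ x)) (trans (cong₂ (emb κ) ef ep) (emb-eta κ y))

block-point : ∀ κ {x z} → fixed κ z ≡ fixed κ x → z ≡ emb κ (fixed κ x) (planar κ z)
block-point κ {x} {z} e = trans (sym (emb-eta κ z)) (cong (λ v → emb κ v (planar κ z)) e)

-- A direction of Δ either stays inside the blocks of kind κ
-- (idir κ) or moves the fixed coordinate along a slope (odir κ).
data PDir : Set where
  pA : PDir
  pD : Slope → PDir

stepPl : PDir → Pl → Pl
stepPl pA     (t , a) = t , a ⊕ f1
stepPl (pD s) (t , a) = t +V slV s , a ⊕ det t (slV s)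

idir : Kind → PDir → Dir
idir κ  pA     = dA
idir KR (pD s) = dP s
idir KP (pD s) = dR s

odir : Kind → Slope → Dir
odir KR s = dR s
odir KP s = dP s

innerDir : Dir → Kind × PDir
innerDir dA     = KR , pA
innerDir (dP s) = KR , pD s
innerDir (dR s) = KP , pD s

idir-innerDir : ∀ δ → idir (proj₁ (innerDir δ)) (proj₂ (innerDir δ)) ≡ δ
idir-innerDir dA     = refl
idir-innerDir (dP s) = refl
idir-innerDir (dR s) = refl

dirKind : ∀ κ δ → (Σ PDir λ δ' → δ ≡ idir κ δ') ⊎ (Σ Slope λ s → δ ≡ odir κ s)
dirKind KR dA     = inj₁ (pA , refl)
dirKind KR (dP s) = inj₁ (pD s , refl)
dirKind KR (dR s) = inj₂ (s , refl)
dirKind KP dA     = inj₁ (pA , refl)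
dirKind KP (dP s) = inj₂ (s , refl)
dirKind KP (dR s) = inj₁ (pD s , refl)

fixed-step : ∀ κ δ x → fixed κ (step (idir κ δ) x) ≡ fixed κ x
fixed-step KR pA     x = refl
fixed-step KR (pD s) x = refl
fixed-step KP pA     x = refl
fixed-step KP (pD s) x = refl

planar-step : ∀ κ δ x → planar κ (step (idir κ δ) x) ≡ stepPl δ (planar κ x)
planar-step KR pA     x = refl
planar-step KR (pD s) x = refl
planar-step KP pA     x = refl
planar-step KP (pD s) x = refl

step-emb : ∀ κ δ v p → step (idir κ δ) (emb κ v p) ≡ emb κ v (stepPl δ p)
step-emb KR pA     v p = refl
step-emb KR (pD s) v p = refl
step-emb KP pA     v p = refl
step-emb KP (pD s) v p = refl

fixed-ostep : ∀ κ s x → fixed κ (step (odir κ s) x) ≡ fixed κ x +V slV s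
fixed-ostep KR s x = refl
fixed-ostep KP s x = refl

ostep-leaves : ∀ κ s z → fixed κ (step (odir κ s) z) ≢ fixed κ z
ostep-leaves κ s z e = slope-nonzero (fixed κ z) s (trans (sym (fixed-ostep κ s z)) e)

pos : Point → Dir → F3 → Point
pos z δ f0 = z
pos z δ f1 = step δ z
pos z δ f2 = step δ (step δ z)

plpos : Pl → PDir → F3 → Pl
plpos p δ f0 = p
plpos p δ f1 = stepPl δ p
plpos p δ f2 = stepPl δ (stepPl δ p)

onLine-pos : ∀ {y z δ} → OnLine y (z , δ) → Σ F3 λ i → y ≡ pos z δ i
onLine-pos (inj₁ e)        = f0 , e
onLine-pos (inj₂ (inj₁ e)) = f1 , e
onLine-pos (inj₂ (inj₂ e)) = f2 , e

pos-onLine : ∀ z δ i → OnLine (pos z δ i) (z , δ)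
pos-onLine z δ f0 = inj₁ refl
pos-onLine z δ f1 = inj₂ (inj₁ refl)
pos-onLine z δ f2 = inj₂ (inj₂ refl)

fixed-pos : ∀ κ w δ i → fixed κ (pos w (idir κ δ) i) ≡ fixed κ w
fixed-pos κ w δ f0 = refl
fixed-pos κ w δ f1 = fixed-step κ δ w
fixed-pos κ w δ f2 = trans (fixed-step κ δ _) (fixed-step κ δ w)

pos-emb : ∀ κ v p δ i → pos (emb κ v p) (idir κ δ) i ≡ emb κ v (plpos p δ i)
pos-emb κ v p δ f0 = refl
pos-emb κ v p δ f1 = step-emb κ δ v p
pos-emb κ v p δ f2 = trans (cong (step (idir κ δ)) (step-emb κ δ v p)) (step-emb κ δ v _)

line-point : ∀ κ x δ i → pos x (idir κ δ) i ≡ emb κ (fixed κ x) (plpos (planar κ x) δ i)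
line-point κ x δ i = trans (cong (λ y → pos y (idir κ δ) i) (sym (emb-eta κ x)))
                           (pos-emb κ (fixed κ x) (planar κ x) δ i)

-- The planar model: Pl with the lines  {p , stepPl δ p , stepPl δ (stepPl δ p)}
-- is Q(5,2).

_≟Pl_ : DecidableEquality Pl
_≟Pl_ = ≡-dec _≟V_ _≟F_

∀Pl? : {P : Pl → Set} → Decidable P → Dec (∀ p → P p)
∀Pl? P? = map′ (λ h p → h (proj₁ p) (proj₂ p)) (λ h t a → h (t , a))
               (∀V? λ t → ∀F? λ a → P? (t , a))

∃Pl? : {P : Pl → Set} → Decidable P → Dec (Σ Pl P)
∃Pl? P? = map′ (λ { (a , b , c , p) → ((a , b) , c) , p }) (λ { (((a , b) , c) , p) → a , b , c , p })
               (∃F? λ a → ∃F? λ b → ∃F? λ c → P? ((a , b) , c))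

∀PD? : {P : PDir → Set} → Decidable P → Dec (∀ δ → P δ)
∀PD? P? = map′ (λ { (p , q) pA → p ; (p , q) (pD s) → q s }) (λ h → h pA , λ s → h (pD s))
               (P? pA ×-dec ∀S? (λ s → P? (pD s)))

∃PD? : {P : PDir → Set} → Decidable P → Dec (Σ PDir P)
∃PD? P? = map′ (λ { (inj₁ p) → pA , p ; (inj₂ (s , q)) → pD s , q })
               (λ { (pA , p) → inj₁ p ; (pD s , q) → inj₂ (s , q) })
               (P? pA ⊎-dec ∃S? (λ s → P? (pD s)))

PCol : Pl → Pl → Set
PCol (t , a) (t' , a') = (t ≡ t' × a ≢ a') ⊎ (t ≢ t' × a' ≡ a ⊕ det t t')

PCol? : ∀ p p' → Dec (PCol p p')
PCol? (t , a) (t' , a') =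
  (t ≟V t' ×-dec ¬? (a ≟F a')) ⊎-dec (¬? (t ≟V t') ×-dec a' ≟F a ⊕ det t t')

PAdj : PDir → Pl → Pl → Set
PAdj δ p p' = p' ≡ stepPl δ p ⊎ p' ≡ stepPl δ (stepPl δ p)

opaque
  pcol⇒padj : ∀ p p' → PCol p p' → Σ PDir λ δ → PAdj δ p p'
  pcol⇒padj = decided (∀Pl? λ p → ∀Pl? λ p' → PCol? p p' →-dec
    ∃PD? λ δ → p' ≟Pl stepPl δ p ⊎-dec p' ≟Pl stepPl δ (stepPl δ p)) refl

  padj⇒pcol : ∀ δ p → PCol p (stepPl δ p) × PCol p (stepPl δ (stepPl δ p))
  padj⇒pcol = decided (∀PD? λ δ → ∀Pl? λ p →
    PCol? p (stepPl δ p) ×-dec PCol? p (stepPl δ (stepPl δ p))) refl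

-- Collinearity in Δ.  A line is  {z , s z , s² z}  with  s = step δ  of
-- order 3, so distinct points are collinear iff one is reached from the
-- other by one or two steps in some direction.

opaque
  step³ : ∀ δ x → step δ (step δ (step δ x)) ≡ x
  step³ = decided (∀D? λ δ → ∀P? λ x → step δ (step δ (step δ x)) ≟P x) refl

  step-ne : ∀ δ x → x ≢ step δ x × x ≢ step δ (step δ x)
  step-ne = decided (∀D? λ δ → ∀P? λ x → ¬? (x ≟P step δ x) ×-dec ¬? (x ≟P step δ (step δ x))) refl

Adjacent : Dir → Point → Point → Set
Adjacent δ x y = y ≡ step δ x ⊎ y ≡ step δ (step δ x)

adjacent⇒collinear : ∀ δ {x y} → Adjacent δ x y → Collinear x y
adjacent⇒collinear δ {x} (inj₁ refl) = proj₁ (step-ne δ x) , (x , δ) , inj₁ refl , inj₂ (inj₁ refl)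
adjacent⇒collinear δ {x} (inj₂ refl) = proj₂ (step-ne δ x) , (x , δ) , inj₁ refl , inj₂ (inj₂ refl)

collinear⇒adjacent : ∀ {x y} → Collinear x y → Σ Dir λ δ → Adjacent δ x y
collinear⇒adjacent (x≢y , (z , δ) , inj₁ refl , inj₁ refl) = ⊥-elim (x≢y refl)
collinear⇒adjacent (x≢y , (z , δ) , inj₁ refl , inj₂ (inj₁ refl)) = δ , inj₁ refl
collinear⇒adjacent (x≢y , (z , δ) , inj₁ refl , inj₂ (inj₂ refl)) = δ , inj₂ refl
collinear⇒adjacent (x≢y , (z , δ) , inj₂ (inj₁ refl) , inj₁ refl) = δ , inj₂ (sym (step³ δ z))
collinear⇒adjacent (x≢y , (z , δ) , inj₂ (inj₁ refl) , inj₂ (inj₁ refl)) = ⊥-elim (x≢y refl)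
collinear⇒adjacent (x≢y , (z , δ) , inj₂ (inj₁ refl) , inj₂ (inj₂ refl)) = δ , inj₁ refl
collinear⇒adjacent (x≢y , (z , δ) , inj₂ (inj₂ refl) , inj₁ refl) = δ , inj₁ (sym (step³ δ z))
collinear⇒adjacent (x≢y , (z , δ) , inj₂ (inj₂ refl) , inj₂ (inj₁ refl)) =
  δ , inj₂ (cong (step δ) (sym (step³ δ z)))
collinear⇒adjacent (x≢y , (z , δ) , inj₂ (inj₂ refl) , inj₂ (inj₂ refl)) = ⊥-elim (x≢y refl)

BlockCol : Kind → Point → Point → Set
BlockCol κ x y = fixed κ x ≡ fixed κ y × PCol (planar κ x) (planar κ y)

adjacent⇒blockCol : ∀ κ δ {x y} → Adjacent (idir κ δ) x y → BlockCol κ x y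
adjacent⇒blockCol κ δ {x} (inj₁ refl) =
  sym (fixed-step κ δ x) ,
  subst (PCol (planar κ x)) (sym (planar-step κ δ x)) (proj₁ (padj⇒pcol δ (planar κ x)))
adjacent⇒blockCol κ δ {x} (inj₂ refl) =
  sym (trans (fixed-step κ δ _) (fixed-step κ δ x)) ,
  subst (PCol (planar κ x)) (sym (trans (planar-step κ δ _) (cong (stepPl δ) (planar-step κ δ x))))
        (proj₂ (padj⇒pcol δ (planar κ x)))

blockCol⇒adjacent : ∀ κ {x y} → BlockCol κ x y → Σ PDir λ δ → Adjacent (idir κ δ) x y
blockCol⇒adjacent κ {x} {y} (ef , pc) with pcol⇒padj (planar κ x) (planar κ y) pc
... | δ , inj₁ e = δ , inj₁ (point-ext κ (trans (sym ef) (sym (fixed-step κ δ x)))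
                                        (trans e (sym (planar-step κ δ x))))
... | δ , inj₂ e = δ , inj₂ (point-ext κ
        (trans (sym ef) (sym (trans (fixed-step κ δ _) (fixed-step κ δ x))))
        (trans e (sym (trans (planar-step κ δ _) (cong (stepPl δ) (planar-step κ δ x))))))

collinear⇔blockCol : ∀ {x y} → Collinear x y ⇔ (Σ Kind λ κ → BlockCol κ x y)
collinear⇔blockCol = mk⇔ to from
  where
  to : ∀ {x y} → Collinear x y → Σ Kind λ κ → BlockCol κ x y
  to c with collinear⇒adjacent c
  ... | δ , adj = proj₁ (innerDir δ) , adjacent⇒blockCol (proj₁ (innerDir δ)) (proj₂ (innerDir δ))
                    (subst (λ d → Adjacent d _ _) (sym (idir-innerDir δ)) adj)
  from : ∀ {x y} → (Σ Kind λ κ → BlockCol κ x y) → Collinear x y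
  from (κ , bc) with blockCol⇒adjacent κ bc
  ... | δ , adj = adjacent⇒collinear (idir κ δ) adj

col? : ∀ x y → Dec (Collinear x y)
col? x y = map′ (Equivalence.from collinear⇔blockCol) (Equivalence.to collinear⇔blockCol)
                (∃K? λ κ → fixed κ x ≟V fixed κ y ×-dec PCol? (planar κ x) (planar κ y))

collinear-within : ∀ κ {x y} → fixed κ x ≡ fixed κ y → Collinear x y ⇔ PCol (planar κ x) (planar κ y)
collinear-within κ {x} {y} ef = mk⇔ to (λ pc → Equivalence.from collinear⇔blockCol (κ , ef , pc))
  where
  via-other : ∀ κ → fixed κ x ≡ fixed κ y → BlockCol (other κ) x y → PCol (planar κ x) (planar κ y)
  via-other KR ef (em , inj₁ (_ , a≢)) = inj₁ (em , a≢)
  via-other KR ef (em , inj₂ (n , _))  = ⊥-elim (n ef)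
  via-other KP ef (em , inj₁ (_ , a≢)) = inj₁ (em , a≢)
  via-other KP ef (em , inj₂ (n , _))  = ⊥-elim (n ef)
  to : Collinear x y → PCol (planar κ x) (planar κ y)
  to c with Equivalence.to collinear⇔blockCol c
  ... | κ' , bc with kinds κ κ'
  ... | inj₁ refl = proj₂ bc
  ... | inj₂ refl = via-other κ ef bc

collinear-across : ∀ κ {x y} → fixed κ x ≢ fixed κ y →
  Collinear x y ⇔ (moving κ x ≡ moving κ y × level y ≡ level x ⊕ det (fixed κ x) (fixed κ y))
collinear-across κ {x} {y} n = mk⇔ to (λ h → Equivalence.from collinear⇔blockCol (other κ , from-other κ n h))
  where
  via-other : ∀ κ → fixed κ x ≢ fixed κ y → BlockCol (other κ) x y →
              moving κ x ≡ moving κ y × level y ≡ level x ⊕ det (fixed κ x) (fixed κ y)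
  via-other KR n (em , inj₁ (ef , _)) = ⊥-elim (n ef)
  via-other KR n (em , inj₂ (_ , e))  = em , e
  via-other KP n (em , inj₁ (ef , _)) = ⊥-elim (n ef)
  via-other KP n (em , inj₂ (_ , e))  = em , e
  from-other : ∀ κ → fixed κ x ≢ fixed κ y →
               moving κ x ≡ moving κ y × level y ≡ level x ⊕ det (fixed κ x) (fixed κ y) →
               BlockCol (other κ) x y
  from-other KR n (em , e) = em , inj₂ (n , e)
  from-other KP n (em , e) = em , inj₂ (n , e)
  to : Collinear x y → moving κ x ≡ moving κ y × level y ≡ level x ⊕ det (fixed κ x) (fixed κ y)
  to c with Equivalence.to collinear⇔blockCol c
  ... | κ' , bc with kinds κ κ'
  ... | inj₁ refl = ⊥-elim (n (proj₁ bc))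
  ... | inj₂ refl = via-other κ n bc

emb-collinear : ∀ κ v p p' → Collinear (emb κ v p) (emb κ v p') ⇔ PCol p p'
emb-collinear κ v p p' =
  subst₂ (λ r r' → Collinear (emb κ v p) (emb κ v p') ⇔ PCol r r') (planar-emb κ v p) (planar-emb κ v p')
         (collinear-within κ (trans (fixed-emb κ v p) (sym (fixed-emb κ v p'))))

index-ne : ∀ {a b z δ i j} → a ≡ pos z δ i → b ≡ pos z δ j → a ≢ b → i ≢ j
index-ne {z = z} {δ} ea eb a≢b e = a≢b (trans ea (trans (cong (pos z δ) e) (sym eb)))

line-four : ∀ {a b c d} (L : Line) → OnLine a L → OnLine b L → OnLine c L → OnLine d L →
            a ≢ b → a ≢ c → a ≢ d → b ≢ c → b ≢ d → c ≢ d → ⊥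
line-four (z , δ) oa ob oc od a≢b a≢c a≢d b≢c b≢d c≢d
  with onLine-pos oa | onLine-pos ob | onLine-pos oc | onLine-pos od
... | i , ea | j , eb | k , ec | l , ed
  with cover i j k (index-ne ea eb a≢b) (index-ne ea ec a≢c) (index-ne eb ec b≢c) l
... | inj₁ e        = index-ne ea ed a≢d (sym e)
... | inj₂ (inj₁ e) = index-ne eb ed b≢d (sym e)
... | inj₂ (inj₂ e) = index-ne ec ed c≢d (sym e)

opaque
  line-sum : ∀ κ z δ → (fixed κ (pos z δ f0) +V fixed κ (pos z δ f1)) +V fixed κ (pos z δ f2) ≡ (f0 , f0)
  line-sum = decided (∀K? λ κ → ∀P? λ z → ∀D? λ δ →
    (fixed κ (pos z δ f0) +V fixed κ (pos z δ f1)) +V fixed κ (pos z δ f2) ≟V (f0 , f0)) refl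

line-third : ∀ κ {a b r} (L : Line) → OnLine a L → OnLine b L → OnLine r L →
             a ≢ b → r ≢ a → r ≢ b → fixed κ r ≡ negV (fixed κ a +V fixed κ b)
line-third κ (z , δ) oa ob or a≢b r≢a r≢b with onLine-pos oa | onLine-pos ob | onLine-pos or
... | i , refl | j , refl | k , refl =
  trans (table3-values g k)
    (trans (zero-sum-third _ _ _ (line-sum κ z δ) i j k
              (index-ne {i = i} {j} refl refl a≢b) (index-ne {i = k} {i} refl refl r≢a)
              (index-ne {i = k} {j} refl refl r≢b))
           (cong₂ (λ u u' → negV (u +V u')) (sym (table3-values g i)) (sym (table3-values g j))))
  where
  g : F3 → V2
  g n = fixed κ (pos z δ n)

∧-split : ∀ {a b} → a ∧ b ≡ true → a ≡ true × b ≡ true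
∧-split {true} e = refl , e

lineIn-pos : ∀ {X z δ} → LineIn (z , δ) X → ∀ i → pos z δ i ∈ X
lineIn-pos {X} {z} l f0 = proj₁ (∧-split {X z} l)
lineIn-pos {X} {z} l f1 = proj₁ (∧-split (proj₂ (∧-split {X z} l)))
lineIn-pos {X} {z} l f2 = proj₂ (∧-split (proj₂ (∧-split {X z} l)))

lineIn-intro : ∀ {X z δ} → (∀ i → pos z δ i ∈ X) → LineIn (z , δ) X
lineIn-intro h rewrite h f0 | h f1 | h f2 = refl

subspace-line : ∀ {X} → IsSubspace X → ∀ {w z} δ → w ∈ X → z ∈ X → Adjacent δ w z → LineIn (w , δ) X
subspace-line {X} sub {w} {z} δ wX zX adj = lineIn-intro {X} λ i →
  sub w z (w , δ) (proj₁ (adjacent⇒collinear δ adj)) (inj₁ refl) (on adj) wX zX _ (pos-onLine w δ i)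
  where
  on : Adjacent δ w z → OnLine z (w , δ)
  on (inj₁ e) = inj₂ (inj₁ e)
  on (inj₂ e) = inj₂ (inj₂ e)

within2 : ∀ {x y} → Within 2 x y → x ≡ y ⊎ Collinear x y ⊎ Σ Point λ w → Collinear x w × Collinear w y
within2 here                      = inj₁ refl
within2 (there c here)            = inj₂ (inj₁ c)
within2 (there c (there c' here)) = inj₂ (inj₂ (_ , c , c'))

convex-mid : ∀ {X x y w} → IsConvex X → x ∈ X → y ∈ X → Collinear x w → Collinear w y →
             x ≢ y → ¬ Collinear x y → w ∈ X
convex-mid {x = x} {y} {w} conv xX yX c₁ c₂ x≢y nc =
  conv x y w 1 1 xX yX (dist1 c₁) (dist1 c₂) (there c₁ (there c₂ here) , far)
  where
  dist1 : ∀ {u v} → Collinear u v → Dist u v 1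
  dist1 c = there c here , λ { zero _ here → proj₁ c refl ; (suc m) (s≤s ()) }
  far : ∀ m → m < 2 → ¬ Within m x y
  far zero _ here = x≢y refl
  far (suc zero) _ here = x≢y refl
  far (suc zero) _ (there c here) = nc c
  far (suc (suc m)) (s≤s (s≤s ())) _

-- Raising all levels by d is an automorphism of Δ, so exhaustive checks
-- about the neighbourhood of a point need only points of level f0.

shift : F3 → Point → Point
shift d (pt p₁ p₂ r₁ r₂ a) = pt p₁ p₂ r₁ r₂ (a ⊕ d)

opaque
  step-shift : ∀ d δ x → step δ (shift d x) ≡ shift d (step δ x)
  step-shift = decided (∀F? λ d → ∀D? λ δ → ∀P? λ x → step δ (shift d x) ≟P shift d (step δ x)) refl

  unshift : ∀ d x → shift (⊝ d) (shift d x) ≡ x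
  unshift = decided (∀F? λ d → ∀P? λ x → shift (⊝ d) (shift d x) ≟P x) refl

shift-injective : ∀ d {x y} → shift d x ≡ shift d y → x ≡ y
shift-injective d {x} {y} e = trans (sym (unshift d x)) (trans (cong (shift (⊝ d)) e) (unshift d y))

shift-collinear : ∀ d {x y} → Collinear x y → Collinear (shift d x) (shift d y)
shift-collinear d c with collinear⇒adjacent c
... | δ , inj₁ refl = adjacent⇒collinear δ (inj₁ (sym (step-shift d δ _)))
... | δ , inj₂ refl =
  adjacent⇒collinear δ (inj₂ (sym (trans (cong (step δ) (step-shift d δ _)) (step-shift d δ _))))

shift-reflects : ∀ d {x y} → Collinear (shift d x) (shift d y) → Collinear x y
shift-reflects d c = subst₂ Collinear (unshift d _) (unshift d _) (shift-collinear (⊝ d) c)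

pos-shift : ∀ d x δ i → pos (shift d x) δ i ≡ shift d (pos x δ i)
pos-shift d x δ f0 = refl
pos-shift d x δ f1 = step-shift d δ x
pos-shift d x δ f2 = trans (cong (step δ) (step-shift d δ x)) (step-shift d δ (step δ x))

-- At a point x of a Q(5,2)-quad X, five of the nine lines through x lie
-- in X.  Either they are the five inner lines of one kind κ (x is pure),
-- or they contain lines in directions dP s , dR s' and a third one; the
-- first two span a grid in X, against whose line (step (dP s) x , dR s')
-- the third line violates the GQ axiom.  At a pure point the whole block
-- lies in X (the planar model is spanned by two lines through a point),
-- and convexity with diameter 2 keeps X inside the block.

-- lines through x in directions dP s and dR s' span a grid: the corner
-- w = step (dR s') y  is a common neighbour of the non-collinear  y , z
opaque
  grid-corner : ∀ x s s' →
    Collinear (step (dR s') (step (dP s) x)) (step (dR s') x)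
    × ¬ Collinear (step (dP s) x) (step (dR s') x) × step (dP s) x ≢ step (dR s') x
  grid-corner = decided (∀P? λ x → ∀S? λ s → ∀S? λ s' →
    col? (step (dR s') (step (dP s) x)) (step (dR s') x)
    ×-dec ¬? (col? (step (dP s) x) (step (dR s') x)) ×-dec ¬? (step (dP s) x ≟P step (dR s') x)) refl

FarFromLine : Point → Slope → Slope → Dir → F3 → Set
FarFromLine x s s' δ i = step δ x ≢ p × ¬ Collinear (step δ x) p
  where p = pos (step (dP s) x) (dR s') i

opaque
  far-from-line₀ : ∀ p₁ p₂ r₁ r₂ s s' δ → δ ≢ dP s → δ ≢ dR s' → ∀ i →
                   FarFromLine (pt p₁ p₂ r₁ r₂ f0) s s' δ i
  far-from-line₀ = decided (∀F? λ p₁ → ∀F? λ p₂ → ∀F? λ r₁ → ∀F? λ r₂ → ∀S? λ s → ∀S? λ s' →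
    ∀D? λ δ → ¬? (δ ≟D dP s) →-dec ¬? (δ ≟D dR s') →-dec ∀F? λ i →
    let x = pt p₁ p₂ r₁ r₂ f0 ; u = step δ x ; p = pos (step (dP s) x) (dR s') i in
    ¬? (u ≟P p) ×-dec ¬? (col? u p)) refl

-- by the level shift, from the points of level f0 to all points
far-from-line : ∀ x s s' δ → δ ≢ dP s → δ ≢ dR s' → ∀ i → FarFromLine x s s' δ i
far-from-line x s s' δ δ≢P δ≢R i =
  (λ e → proj₁ far₀ (shift-injective d (trans (sym u≡) (trans e p≡)))) ,
  (λ c → proj₂ far₀ (shift-reflects d (subst₂ Collinear u≡ p≡ c)))
  where
  d = level x
  x₀ = pt (Point.p₁ x) (Point.p₂ x) (Point.r₁ x) (Point.r₂ x) f0
  far₀ = far-from-line₀ (Point.p₁ x) (Point.p₂ x) (Point.r₁ x) (Point.r₂ x) s s' δ δ≢P δ≢R i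
  u≡ : step δ x ≡ shift d (step δ x₀)
  u≡ = step-shift d δ x₀
  p≡ : pos (step (dP s) x) (dR s') i ≡ shift d (pos (step (dP s) x₀) (dR s') i)
  p≡ = trans (cong (λ y → pos y (dR s') i) (step-shift d (dP s) x₀)) (pos-shift d _ (dR s') i)

linesAt : Subset → Point → Dir → Bool
linesAt X x δ = lineInᵇ X (x , δ)

count : (Dir → Bool) → ℕ
count f = length (filterᵇ f allDirs)

Pure : Kind → (Dir → Bool) → Set
Pure κ f = ∀ δ → f (idir κ δ) ≡ true

Pure? : ∀ κ f → Dec (Pure κ f)
Pure? κ f = ∀PD? λ δ → f (idir κ δ) Bool.≟ true

Mixed : (Dir → Bool) → Set
Mixed f = Σ Slope λ s → Σ Slope λ s' → Σ Dir λ δ →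
          f (dP s) ≡ true × f (dR s') ≡ true × f δ ≡ true × δ ≢ dP s × δ ≢ dR s'

Mixed? : ∀ f → Dec (Mixed f)
Mixed? f = ∃S? λ s → ∃S? λ s' → ∃D? λ δ →
  f (dP s) Bool.≟ true ×-dec f (dR s') Bool.≟ true ×-dec f δ Bool.≟ true
  ×-dec ¬? (δ ≟D dP s) ×-dec ¬? (δ ≟D dR s')

table : Bool → Bool → Bool → Bool → Bool → Bool → Bool → Bool → Bool → Dir → Bool
table b _ _ _ _ _ _ _ _ dA       = b
table _ b _ _ _ _ _ _ _ (dP s10) = b
table _ _ b _ _ _ _ _ _ (dP s01) = b
table _ _ _ b _ _ _ _ _ (dP s11) = b
table _ _ _ _ b _ _ _ _ (dP s12) = b
table _ _ _ _ _ b _ _ _ (dR s10) = b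
table _ _ _ _ _ _ b _ _ (dR s01) = b
table _ _ _ _ _ _ _ b _ (dR s11) = b
table _ _ _ _ _ _ _ _ b (dR s12) = b

table-values : ∀ (f : Dir → Bool) δ → table (f dA) (f (dP s10)) (f (dP s01)) (f (dP s11)) (f (dP s12))
                             (f (dR s10)) (f (dR s01)) (f (dR s11)) (f (dR s12)) δ ≡ f δ
table-values f dA       = refl
table-values f (dP s10) = refl
table-values f (dP s01) = refl
table-values f (dP s11) = refl
table-values f (dP s12) = refl
table-values f (dR s10) = refl
table-values f (dR s01) = refl
table-values f (dR s11) = refl
table-values f (dR s12) = refl

count-cong : ∀ {f g : Dir → Bool} → (∀ δ → f δ ≡ g δ) →
             ∀ ds → length (filterᵇ f ds) ≡ length (filterᵇ g ds)
count-cong h [] = refl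
count-cong {f} {g} h (d ∷ ds) rewrite h d with g d
... | true  = cong suc (count-cong h ds)
... | false = count-cong h ds

opaque
  five-directions-table : ∀ b₁ b₂ b₃ b₄ b₅ b₆ b₇ b₈ b₉ →
    let f = table b₁ b₂ b₃ b₄ b₅ b₆ b₇ b₈ b₉ in count f ≡ 5 → Pure KR f ⊎ Pure KP f ⊎ Mixed f
  five-directions-table = decided (∀B? λ b₁ → ∀B? λ b₂ → ∀B? λ b₃ → ∀B? λ b₄ → ∀B? λ b₅ →
    ∀B? λ b₆ → ∀B? λ b₇ → ∀B? λ b₈ → ∀B? λ b₉ →
    let f = table b₁ b₂ b₃ b₄ b₅ b₆ b₇ b₈ b₉ in
    count f ℕ.≟ 5 →-dec (Pure? KR f ⊎-dec Pure? KP f ⊎-dec Mixed? f)) refl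

five-directions : ∀ (f : Dir → Bool) → count f ≡ 5 → Pure KR f ⊎ Pure KP f ⊎ Mixed f
five-directions f c = transfer (five-directions-table (f dA) (f (dP s10)) (f (dP s01)) (f (dP s11))
  (f (dP s12)) (f (dR s10)) (f (dR s01)) (f (dR s11)) (f (dR s12)) (trans (count-cong {g} {f} (table-values f) allDirs) c))
  where
  g = table (f dA) (f (dP s10)) (f (dP s01)) (f (dP s11)) (f (dP s12))
            (f (dR s10)) (f (dR s01)) (f (dR s11)) (f (dR s12))
  ok : ∀ {δ} → g δ ≡ true → f δ ≡ true
  ok {δ} = trans (sym (table-values f δ))
  transfer : Pure KR g ⊎ Pure KP g ⊎ Mixed g → Pure KR f ⊎ Pure KP f ⊎ Mixed f
  transfer (inj₁ p)        = inj₁ (λ δ → ok (p δ))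
  transfer (inj₂ (inj₁ p)) = inj₂ (inj₁ (λ δ → ok (p δ)))
  transfer (inj₂ (inj₂ (s , s' , δ , e₁ , e₂ , e₃ , n₁ , n₂))) =
    inj₂ (inj₂ (s , s' , δ , ok e₁ , ok e₂ , ok e₃ , n₁ , n₂))

mixed-impossible : ∀ {X} → IsQ52Quad X → ∀ x → Mixed (linesAt X x) → ⊥
mixed-impossible {X} ((sub , conv , _) , gq) x (s , s' , δ , lP , lR , lδ , δ≢P , δ≢R) =
  no-neighbour (proj₂ (proj₂ gq) u (y , dR s') uX MX u∉M)
  where
  y = step (dP s) x
  u = step δ x
  yX = lineIn-pos {X} {x} {dP s} lP f1
  uX = lineIn-pos {X} {x} {δ} lδ f1
  corner = grid-corner x s s'
  wX : step (dR s') y ∈ X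
  wX = convex-mid conv yX (lineIn-pos {X} {x} {dR s'} lR f1) (adjacent⇒collinear (dR s') (inj₁ refl))
                  (proj₁ corner) (proj₂ (proj₂ corner)) (proj₁ (proj₂ corner))
  MX : LineIn (y , dR s') X
  MX = subspace-line sub (dR s') yX wX (inj₁ refl)
  far = far-from-line x s s' δ δ≢P δ≢R
  u∉M : ¬ OnLine u (y , dR s')
  u∉M o with onLine-pos o
  ... | i , e = proj₁ (far i) e
  no-neighbour : ∃! _≡_ (λ p → OnLine p (y , dR s') × Collinear u p) → ⊥
  no-neighbour (p , (o , c) , _) with onLine-pos o
  ... | i , e = proj₂ (far i) (subst (Collinear u) e c)

Corner : Pl → Pl → Pl → Set
Corner p₁ p₂ r = PCol p₁ r × PCol r p₂ × ¬ PCol p₁ p₂ × p₁ ≢ p₂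

Reach : Pl → Pl → Set
Reach q r = (Σ PDir λ δ → Σ F3 λ i → r ≡ plpos q δ i)
          ⊎ (Σ F3 λ i → Σ F3 λ j → Corner (plpos q pA i) (plpos q (pD s10) j) r)

opaque
  planar-reach : ∀ q r → Reach q r
  planar-reach = decided (∀Pl? λ q → ∀Pl? λ r →
    (∃PD? λ δ → ∃F? λ i → r ≟Pl plpos q δ i) ⊎-dec
    (∃F? λ i → ∃F? λ j → let p₁ = plpos q pA i ; p₂ = plpos q (pD s10) j in
       PCol? p₁ r ×-dec PCol? r p₂ ×-dec ¬? (PCol? p₁ p₂) ×-dec ¬? (p₁ ≟Pl p₂))) refl

PureAt : Subset → Kind → Point → Set
PureAt X κ x = Pure κ (linesAt X x)

pure-block⊆ : ∀ {X} κ → IsQ52Quad X → ∀ x → PureAt X κ x → ∀ z → fixed κ z ≡ fixed κ x → z ∈ X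
pure-block⊆ {X} κ ((_ , conv , _) , _) x pure z ez =
  subst (_∈ X) (sym (block-point κ ez)) (reach (planar-reach q (planar κ z)))
  where
  v = fixed κ x
  q = planar κ x
  onLines : ∀ δ i → emb κ v (plpos q δ i) ∈ X
  onLines δ i = subst (_∈ X) (line-point κ x δ i) (lineIn-pos {X} {x} {idir κ δ} (pure δ) i)
  reach : ∀ {r} → Reach q r → emb κ v r ∈ X
  reach (inj₁ (δ , i , refl)) = onLines δ i
  reach (inj₂ (i , j , c₁ , c₂ , nc , ne)) =
    convex-mid conv (onLines pA i) (onLines (pD s10) j)
      (Equivalence.from (emb-collinear κ v _ _) c₁) (Equivalence.from (emb-collinear κ v _ _) c₂)
      (λ e → ne (trans (sym (planar-emb κ v _)) (trans (cong (planar κ) e) (planar-emb κ v _))))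
      (λ c → nc (Equivalence.to (emb-collinear κ v _ _) c))

-- a line of X through a pure point stays in its block: a leaving line, an
-- inner line and the vertical line would be mixed
pure-neighbour : ∀ {X} κ → IsQ52Quad X → ∀ {w z} → PureAt X κ w → z ∈ X → Collinear w z →
                 fixed κ z ≡ fixed κ w
pure-neighbour {X} κ q52@((sub , _ , _) , _) {w} {z} pure zX c with collinear⇒adjacent c
... | δ , adj with dirKind κ δ
... | inj₁ (δ' , refl) = sym (proj₁ (adjacent⇒blockCol κ δ' adj))
... | inj₂ (s , refl) = ⊥-elim (mixed-impossible q52 w (mixed κ pure leaving))
  where
  leaving : LineIn (w , odir κ s) X
  leaving = subspace-line sub (odir κ s) (lineIn-pos {X} {w} {dA} (pure pA) f0) zX adj
  mixed : ∀ κ → PureAt X κ w → LineIn (w , odir κ s) X → Mixed (linesAt X w)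
  mixed KR pure l = s10 , s , dA , pure (pD s10) , l , pure pA , (λ ()) , (λ ())
  mixed KP pure l = s , s10 , dA , l , pure (pD s10) , pure pA , (λ ()) , (λ ())

pure-spread : ∀ {X} κ → IsQ52Quad X → ∀ x → PureAt X κ x →
              ∀ w → fixed κ w ≡ fixed κ x → PureAt X κ w
pure-spread {X} κ q52 x pure w e δ =
  lineIn-intro {X} λ i → pure-block⊆ κ q52 x pure _ (trans (fixed-pos κ w δ i) e)

-- X has diameter 2, so it does not leave the block of a pure point
pure-quad⊆block : ∀ {X} κ → IsQ52Quad X → ∀ x → PureAt X κ x →
                  ∀ z → z ∈ X → fixed κ z ≡ fixed κ x
pure-quad⊆block {X} κ q52@((_ , conv , diam) , _) x pure z zX =
  by-distance (within2 (proj₁ diam x z xX zX))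
  where
  xX = lineIn-pos {X} {x} {dA} (pure pA) f0
  through : ∀ w → Collinear x w → Collinear w z → Dec (x ≡ z) → Dec (Collinear x z) →
            fixed κ z ≡ fixed κ x
  through w c₁ c₂ (yes refl) _       = refl
  through w c₁ c₂ (no _)     (yes c) = pure-neighbour κ q52 pure zX c
  through w c₁ c₂ (no x≢z)   (no nc) = trans (pure-neighbour κ q52 (pure-spread κ q52 x pure w wx) zX c₂) wx
    where
    wx = pure-neighbour κ q52 pure (convex-mid conv xX zX c₁ c₂ x≢z nc) c₁
  by-distance : x ≡ z ⊎ Collinear x z ⊎ Σ Point (λ w → Collinear x w × Collinear w z) →
                fixed κ z ≡ fixed κ x
  by-distance (inj₁ refl)                 = refl
  by-distance (inj₂ (inj₁ c))             = pure-neighbour κ q52 pure zX c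
  by-distance (inj₂ (inj₂ (w , c₁ , c₂))) = through w c₁ c₂ (x ≟P z) (col? x z)

Block : Kind → V2 → Pred
Block κ v z = fixed κ z ≡ v

opaque
  q52-is-block : ∀ {X} → IsQ52Quad X → ∀ x → x ∈ X → Σ Kind λ κ → ⟦ X ⟧ ≐ Block κ (fixed κ x)
  q52-is-block {X} q52 x xX = by-profile (five-directions (linesAt X x) (proj₁ (proj₂ (proj₂ q52)) x xX))
    where
    block : ∀ κ → PureAt X κ x → ⟦ X ⟧ ≐ Block κ (fixed κ x)
    block κ pure z = mk⇔ (pure-quad⊆block κ q52 x pure z) (pure-block⊆ κ q52 x pure z)
    by-profile : PureAt X KR x ⊎ PureAt X KP x ⊎ Mixed (linesAt X x) →
                 Σ Kind λ κ → ⟦ X ⟧ ≐ Block κ (fixed κ x)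
    by-profile (inj₁ pure)         = KR , block KR pure
    by-profile (inj₂ (inj₁ pure))  = KP , block KP pure
    by-profile (inj₂ (inj₂ mixed)) = ⊥-elim (mixed-impossible q52 x mixed)

∈-dec : ∀ (X : Subset) z → z ∈ X ⊎ z ∉ X
∈-dec X z with X z
... | true  = inj₁ refl
... | false = inj₂ λ ()

lift : Kind → V2 → (Pl → Bool) → Subset
lift κ v Y z = does (fixed κ z ≟V v) ∧ Y (planar κ z)

lift-fixed : ∀ κ v Y z → z ∈ lift κ v Y → fixed κ z ≡ v
lift-fixed κ v Y z e = decided (fixed κ z ≟V v) (proj₁ (∧-split e))

lift-planar : ∀ κ v Y z → z ∈ lift κ v Y → Y (planar κ z) ≡ true
lift-planar κ v Y z e = proj₂ (∧-split {does (fixed κ z ≟V v)} e)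

lift-point : ∀ κ v Y z → z ∈ lift κ v Y → z ≡ emb κ v (planar κ z)
lift-point κ v Y z e = trans (sym (emb-eta κ z)) (cong (λ u → emb κ u (planar κ z)) (lift-fixed κ v Y z e))

lift-intro : ∀ κ v Y z → fixed κ z ≡ v → Y (planar κ z) ≡ true → z ∈ lift κ v Y
lift-intro κ v Y z e y rewrite dec-true (fixed κ z ≟V v) e = y

lift-emb : ∀ κ v Y p → lift κ v Y (emb κ v p) ≡ Y p
lift-emb KR v Y p rewrite dec-true (v ≟V v) refl = refl
lift-emb KP v Y p rewrite dec-true (v ≟V v) refl = refl

lift-outside : ∀ κ v Y z → fixed κ z ≢ v → lift κ v Y z ≡ false
lift-outside κ v Y z n rewrite dec-false (fixed κ z ≟V v) n = refl

planarLine : (Pl → Bool) → Pl → PDir → Bool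
planarLine Y p δ = Y p ∧ Y (stepPl δ p) ∧ Y (stepPl δ (stepPl δ p))

liftDirs : Kind → (PDir → Bool) → Dir → Bool
liftDirs KR h dA     = h pA
liftDirs KR h (dP s) = h (pD s)
liftDirs KR h (dR s) = false
liftDirs KP h dA     = h pA
liftDirs KP h (dP s) = false
liftDirs KP h (dR s) = h (pD s)

liftDirs-idir : ∀ κ h δ → liftDirs κ h (idir κ δ) ≡ h δ
liftDirs-idir KR h pA     = refl
liftDirs-idir KR h (pD s) = refl
liftDirs-idir KP h pA     = refl
liftDirs-idir KP h (pD s) = refl

liftDirs-odir : ∀ κ h s → liftDirs κ h (odir κ s) ≡ false
liftDirs-odir KR h s = refl
liftDirs-odir KP h s = refl

linesAt-lift : ∀ κ v Y p δ → linesAt (lift κ v Y) (emb κ v p) δ ≡ liftDirs κ (planarLine Y p) δ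
linesAt-lift κ v Y p δ with dirKind κ δ
... | inj₁ (δ' , refl)
  rewrite step-emb κ δ' v p | step-emb κ δ' v (stepPl δ' p)
        | lift-emb κ v Y p | lift-emb κ v Y (stepPl δ' p) | lift-emb κ v Y (stepPl δ' (stepPl δ' p))
  = sym (liftDirs-idir κ (planarLine Y p) δ')
... | inj₂ (s , refl)
  rewrite lift-outside κ v Y (step (odir κ s) (emb κ v p))
            (λ e → ostep-leaves κ s (emb κ v p) (trans e (sym (fixed-emb κ v p))))
  = trans (∧-zeroʳ (lift κ v Y (emb κ v p))) (sym (liftDirs-odir κ (planarLine Y p) s))

PlanarGQ : Pl → Pl → PDir → Set
PlanarGQ p r δ = (Σ F3 λ i → p ≡ plpos r δ i)
               ⊎ (Σ F3 λ i → PCol p (plpos r δ i) × ∀ j → PCol p (plpos r δ j) → j ≡ i)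

opaque
  planar-GQ-axiom : ∀ p r δ → PlanarGQ p r δ
  planar-GQ-axiom = decided (∀Pl? λ p → ∀Pl? λ r → ∀PD? λ δ →
    (∃F? λ i → p ≟Pl plpos r δ i) ⊎-dec
    (∃F? λ i → PCol? p (plpos r δ i) ×-dec ∀F? λ j → PCol? p (plpos r δ j) →-dec j ≟F i)) refl

lift-GQ-axiom : ∀ κ v Y x (L : Line) → x ∈ lift κ v Y → LineIn L (lift κ v Y) → ¬ OnLine x L →
                ∃! _≡_ (λ y → OnLine y L × Collinear x y)
lift-GQ-axiom κ v Y x (z , δ) xY LY x∉L with dirKind κ δ
... | inj₂ (s , refl) = ⊥-elim (ostep-leaves κ s z
        (trans (lift-fixed κ v Y _ (lineIn-pos {lift κ v Y} {z} {odir κ s} LY f1))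
               (sym (lift-fixed κ v Y z (lineIn-pos {lift κ v Y} {z} {odir κ s} LY f0)))))
... | inj₁ (δ' , refl) = answer (planar-GQ-axiom (planar κ x) (planar κ z) δ')
  where
  ex = lift-point κ v Y x xY
  ez = lift-point κ v Y z (lineIn-pos {lift κ v Y} {z} {idir κ δ'} LY f0)
  point : ∀ i → pos z (idir κ δ') i ≡ emb κ v (plpos (planar κ z) δ' i)
  point i = trans (cong (λ w → pos w (idir κ δ') i) ez) (pos-emb κ v (planar κ z) δ' i)
  col⇔ : ∀ i → Collinear x (pos z (idir κ δ') i) ⇔ PCol (planar κ x) (plpos (planar κ z) δ' i)
  col⇔ i = subst₂ (λ a b → Collinear a b ⇔ _) (sym ex) (sym (point i))
                  (emb-collinear κ v (planar κ x) (plpos (planar κ z) δ' i))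
  answer : PlanarGQ (planar κ x) (planar κ z) δ' → ∃! _≡_ (λ y → OnLine y (z , idir κ δ') × Collinear x y)
  answer (inj₁ (i , e)) = ⊥-elim (x∉L (subst (λ w → OnLine w (z , idir κ δ'))
    (sym (trans ex (trans (cong (emb κ v) e) (sym (point i))))) (pos-onLine z (idir κ δ') i)))
  answer (inj₂ (i , c , unique)) =
    pos z (idir κ δ') i , (pos-onLine z (idir κ δ') i , Equivalence.from (col⇔ i) c) , same
    where
    same : ∀ {y} → OnLine y (z , idir κ δ') × Collinear x y → pos z (idir κ δ') i ≡ y
    same (o , c') with onLine-pos o
    ... | j , refl = cong (pos z (idir κ δ')) (sym (unique j (Equivalence.to (col⇔ j) c')))

lift-GQ : ∀ κ v Y t → (Σ Pl λ p → Y p ≡ true) →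
          (∀ p → Y p ≡ true → count (liftDirs κ (planarLine Y p)) ≡ suc t) → IsGQ (lift κ v Y) t
lift-GQ κ v Y t (p , Yp) lines = (emb κ v p , trans (lift-emb κ v Y p) Yp) , count-at , lift-GQ-axiom κ v Y
  where
  count-at : ∀ x → x ∈ lift κ v Y → numLinesIn (lift κ v Y) x ≡ suc t
  count-at x xY = subst (λ y → numLinesIn (lift κ v Y) y ≡ suc t) (sym (lift-point κ v Y x xY))
    (trans (count-cong (linesAt-lift κ v Y (planar κ x)) allDirs) (lines (planar κ x) (lift-planar κ v Y x xY)))

-- The affine line  {u | det u (slV s) = o}  is written (s , o).  Over it,
-- C s o j  consists of the planar points (t , a) with t on the line (the
-- 3×3-grid over the line) or with  a = Clevel s o t + j .

OnAff : Slope → F3 → V2 → Set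
OnAff s o u = det u (slV s) ≡ o

lineThrough : V2 → V2 → Slope × F3
lineThrough c c̄ = slopeOf (c̄ +V negV c) , det c (slV (slopeOf (c̄ +V negV c)))

thirdPt : V2 → V2 → V2
thirdPt c c̄ = negV (c +V c̄)

opaque
  lineThrough-points : ∀ c c̄ → c ≢ c̄ → ∀ u →
    OnAff (proj₁ (lineThrough c c̄)) (proj₂ (lineThrough c c̄)) u ⇔ (u ≡ c ⊎ u ≡ c̄ ⊎ u ≡ thirdPt c c̄)
  lineThrough-points = decided (∀V? λ c → ∀V? λ c̄ → ¬? (c ≟V c̄) →-dec ∀V? λ u →
    let on? = det u (slV (proj₁ (lineThrough c c̄))) ≟F proj₂ (lineThrough c c̄)
        pts? = u ≟V c ⊎-dec u ≟V c̄ ⊎-dec u ≟V thirdPt c c̄ in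
    map′ (λ (f , g) → mk⇔ f g) (λ e → Equivalence.to e , Equivalence.from e)
         ((on? →-dec pts?) ×-dec (pts? →-dec on?))) refl

  thirdPt-new : ∀ c c̄ → c ≢ c̄ → thirdPt c c̄ ≢ c × thirdPt c c̄ ≢ c̄
  thirdPt-new = decided (∀V? λ c → ∀V? λ c̄ → ¬? (c ≟V c̄) →-dec
    ¬? (thirdPt c c̄ ≟V c) ×-dec ¬? (thirdPt c c̄ ≟V c̄)) refl

  third-progression : ∀ c c̄ → c ≢ c̄ → Σ Slope λ σ →
      (thirdPt c c̄ +V slV σ ≡ c  × thirdPt c c̄ +V slV σ +V slV σ ≡ c̄)
    ⊎ (thirdPt c c̄ +V slV σ ≡ c̄ × thirdPt c c̄ +V slV σ +V slV σ ≡ c)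
  third-progression = decided (∀V? λ c → ∀V? λ c̄ → ¬? (c ≟V c̄) →-dec ∃S? λ σ →
    let m = thirdPt c c̄ +V slV σ in
    (m ≟V c ×-dec m +V slV σ ≟V c̄) ⊎-dec (m ≟V c̄ ×-dec m +V slV σ ≟V c)) refl

basePt : Slope → F3 → V2
basePt s10 o = f0 , o ⊗ f2
basePt s01 o = o , f0
basePt s11 o = f0 , o ⊗ f2
basePt s12 o = f0 , o ⊗ f2

transversal : Slope → V2 → F3
transversal s01 (u₁ , u₂) = u₂
transversal _   (u₁ , u₂) = u₁

Clevel : Slope → F3 → V2 → F3
Clevel s o t = (⊝ (det d (slV s) ⊗ transversal s d)) ⊕ det (basePt s o) t
  where d = t +V negV (basePt s o)

inC : Slope → F3 → F3 → Pl → Bool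
inC s o j (t , a) = does (det t (slV s) ≟F o) ∨ does (a ≟F Clevel s o t ⊕ j)

opaque
  C-lines : ∀ κ s o j p → inC s o j p ≡ true → count (liftDirs κ (planarLine (inC s o j) p)) ≡ 3
  C-lines = decided (∀K? λ κ → ∀S? λ s → ∀F? λ o → ∀F? λ j → ∀Pl? λ p →
    inC s o j p Bool.≟ true →-dec count (liftDirs κ (planarLine (inC s o j) p)) ℕ.≟ 3) refl

  C-nonempty : ∀ s o j → Σ Pl λ p → inC s o j p ≡ true
  C-nonempty = decided (∀S? λ s → ∀F? λ o → ∀F? λ j → ∃Pl? λ p → inC s o j p Bool.≟ true) refl

  C-shift : ∀ s o j d t a → inC s o (j ⊕ d) (t , a ⊕ d) ≡ inC s o j (t , a)
  C-shift = decided (∀S? λ s → ∀F? λ o → ∀F? λ j → ∀F? λ d → ∀V? λ t → ∀F? λ a →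
    inC s o (j ⊕ d) (t , a ⊕ d) Bool.≟ inC s o j (t , a)) refl

C-on-line : ∀ s o j t a → det t (slV s) ≡ o → inC s o j (t , a) ≡ true
C-on-line s o j t a e rewrite dec-true (det t (slV s) ≟F o) e = refl

C-off-line : ∀ s o j t a → det t (slV s) ≢ o → inC s o j (t , a) ≡ true → a ≡ Clevel s o t ⊕ j
C-off-line s o j t a n e rewrite dec-false (det t (slV s) ≟F o) n = decided (a ≟F Clevel s o t ⊕ j) e

C-graph : ∀ s o j t → inC s o j (t , Clevel s o t ⊕ j) ≡ true
C-graph s o j t rewrite dec-true (Clevel s o t ⊕ j ≟F Clevel s o t ⊕ j) refl =
  ∨-zeroʳ (does (det t (slV s) ≟F o))

-- so the sets C s o j are distinct for distinct j
C-distinct : ∀ s o t → det t (slV s) ≢ o → ∀ j j' → inC s o j' (t , Clevel s o t ⊕ j) ≡ true → j ≡ j'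
C-distinct s o t n j j' e = ⊕-cancelˡ (Clevel s o t) j j' (C-off-line s o j' t _ n e)

-- Projection onto a block: a point w outside the block {fixed κ = v} is
-- collinear with exactly one of its points, the one with the same moving
-- coordinate and level  level w + det (fixed κ w) v .

proj : Kind → V2 → Point → Point
proj κ v w = emb κ v (moving κ w , level w ⊕ det (fixed κ w) v)

proj-self : ∀ κ v w → fixed κ w ≡ v → proj κ v w ≡ w
proj-self κ v w refl = trans (cong (λ a → emb κ (fixed κ w) (moving κ w , a))
                                   (trans (cong (level w ⊕_) (det-self (fixed κ w))) (⊕-identityʳ (level w))))
                             (emb-eta κ w)

proj-spec : ∀ {X} κ v → ⟦ X ⟧ ≐ Block κ v → ∀ w u → IsProj X w u ⇔ u ≡ proj κ v w
proj-spec {X} κ v X≐ w u = mk⇔ to from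
  where
  inX : ∀ {z} → fixed κ z ≡ v → z ∈ X
  inX {z} = Equivalence.from (X≐ z)
  p = proj κ v w
  outside : w ∉ X → u ∈ X → Collinear w u → u ≡ p
  outside w∉ uX c = point-ext κ (trans fu (sym (fixed-emb κ v _)))
    (trans (cong₂ _,_ (sym (proj₁ moved)) (trans (proj₂ moved) (cong (λ x → level w ⊕ det (fixed κ w) x) fu)))
           (sym (planar-emb κ v _)))
    where
    fu = Equivalence.to (X≐ u) uX
    moved = Equivalence.to (collinear-across κ (λ e → w∉ (inX (trans e fu)))) c
  to : IsProj X w u → u ≡ p
  to (wX⇒ , w∉⇒) with ∈-dec X w
  ... | inj₁ wX = trans (wX⇒ wX) (sym (proj-self κ v w (Equivalence.to (X≐ w) wX)))
  ... | inj₂ w∉ = outside w∉ (proj₁ (w∉⇒ w∉)) (proj₂ (w∉⇒ w∉))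
  collinear : w ∉ X → Collinear w p
  collinear w∉ = Equivalence.from (collinear-across κ (λ e → w∉ (inX (trans e (fixed-emb κ v _)))))
    (sym (moving-emb κ v _) ,
     trans (level-emb κ v _) (cong (λ x → level w ⊕ det (fixed κ w) x) (sym (fixed-emb κ v _))))
  from : u ≡ p → IsProj X w u
  from refl = (λ wX → proj-self κ v w (Equivalence.to (X≐ w) wX)) ,
              λ w∉ → inX (fixed-emb κ v _) , collinear w∉

proj-emb : ∀ κ v v' p → proj κ v' (emb κ v p) ≡ emb κ v' (proj₁ p , proj₂ p ⊕ det v v')
proj-emb κ v v' p = cong (emb κ v') (cong₂ _,_ (moving-emb κ v p)
  (cong₂ (λ a u → a ⊕ det u v') (level-emb κ v p) (fixed-emb κ v p)))

≐-sym : ∀ {A B : Pred} → A ≐ B → B ≐ A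
≐-sym h z = mk⇔ (Equivalence.from (h z)) (Equivalence.to (h z))

≐-trans : ∀ {A B C : Pred} → A ≐ B → B ≐ C → A ≐ C
≐-trans h h' z = mk⇔ (λ a → Equivalence.to (h' z) (Equivalence.to (h z) a))
                     (λ c → Equivalence.from (h z) (Equivalence.from (h' z) c))

crossing : ∀ κ v w → Σ Point λ z → fixed κ z ≡ v × fixed (other κ) z ≡ w
crossing κ v w = emb κ v (w , f0) , fixed-emb κ v _ , trans (fixed-other κ _) (moving-emb κ v _)

module InSetting (σ : Setting) where
  open Setting σ

  Q-block : Σ Kind λ κ → ⟦ Q ⟧ ≐ Block κ (fixed κ q)
  Q-block = q52-is-block (proj₂ (proj₂ T₁-part) q) q (proj₁ T₁-part q)

  κ : Kind
  κ = proj₁ Q-block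

  κ̄ : Kind
  κ̄ = other κ

  c : V2
  c = fixed κ q

  -- T₁ consists of blocks of kind κ : a block of kind κ̄ in T₁ would meet Q,
  -- hence coincide with it, but it misses points of Q
  T₁-block : ∀ y → ⟦ blk₁ y ⟧ ≐ Block κ (fixed κ y)
  T₁-block y with q52-is-block (proj₂ (proj₂ T₁-part) y) y (proj₁ T₁-part y)
  ... | κ' , h with kinds κ κ'
  ... | inj₁ refl = h
  ... | inj₂ refl = ⊥-elim (slope-nonzero (fixed κ̄ y) s10
                      (trans (sym (proj₂ (proj₂ z₀-cross))) (Equivalence.to (h z₀) z₀∈blk)))
    where
    meet = crossing κ c (fixed κ̄ y)
    z₀-cross = crossing κ c (fixed κ̄ y +V slV s10)
    z₀ = proj₁ z₀-cross
    same : ∀ z → blk₁ q z ≡ blk₁ y z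
    same z = trans (sym (proj₁ (proj₂ T₁-part) q (proj₁ meet)
                           (Equivalence.from (proj₂ Q-block _) (proj₁ (proj₂ meet))) z))
                   (proj₁ (proj₂ T₁-part) y (proj₁ meet) (Equivalence.from (h _) (proj₂ (proj₂ meet))) z)
    z₀∈blk : z₀ ∈ blk₁ y
    z₀∈blk = trans (sym (same z₀)) (Equivalence.from (proj₂ Q-block z₀) (proj₁ (proj₂ z₀-cross)))

  -- T₂ consists of blocks of kind κ̄ : a block of kind κ in T₂ would equal the
  -- T₁-block it meets, but that meet is a single line
  T₂-block : ∀ y → ⟦ blk₂ y ⟧ ≐ Block κ̄ (fixed κ̄ y)
  T₂-block y with q52-is-block (proj₂ (proj₂ T₂-part) y) y (proj₁ T₂-part y)
  ... | κ' , h with kinds κ κ'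
  ... | inj₂ refl = h
  ... | inj₁ refl = ⊥-elim (line-four L (on y₀ refl) (on y₁ (fixed-pos κ y pA f1)) (on y₂ (fixed-pos κ y pA f2))
                      (on u (fixed-step κ (pD s10) y))
                      (proj₁ (step-ne dA y)) (proj₂ (step-ne dA y)) (u-new f0)
                      (proj₁ (step-ne dA y₁)) (u-new f1) (u-new f2))
    where
    L = proj₁ (T₁T₂-meet y y)
    on : ∀ z → fixed κ z ≡ fixed κ y → OnLine z L
    on z e = Equivalence.to (proj₂ (T₁T₂-meet y y) z) (Equivalence.from (T₁-block y z) e , Equivalence.from (h z) e)
    y₀ = pos y dA f0
    y₁ = pos y dA f1
    y₂ = pos y dA f2
    u = step (idir κ (pD s10)) y
    vertical : ∀ i → moving κ (pos y dA i) ≡ moving κ y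
    vertical f0 = refl
    vertical f1 = cong proj₁ (planar-step κ pA y)
    vertical f2 = trans (cong proj₁ (planar-step κ pA y₁)) (cong proj₁ (planar-step κ pA y))
    u-new : ∀ i → pos y dA i ≢ u
    u-new i e = slope-nonzero (moving κ y) s10
      (trans (sym (cong proj₁ (planar-step κ (pD s10) y))) (trans (cong (moving κ) (sym e)) (vertical i)))

  T₁-same : ∀ y y' → fixed κ y ≡ fixed κ y' → ⟦ blk₁ y ⟧ ≐ ⟦ blk₁ y' ⟧
  T₁-same y y' e = ≐-trans (T₁-block y) (≐-trans (λ z → mk⇔ (λ e' → trans e' e) (λ e' → trans e' (sym e)))
                                                 (≐-sym (T₁-block y')))

  PL : Line → V2
  PL L = fixed κ̄ (proj₁ L)

  R-block : ∀ L → ⟦ R_ L ⟧ ≐ Block κ̄ (PL L)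
  R-block L = T₂-block (proj₁ L)

  spread-line : ∀ L → InS L → ∀ z → OnLine z L ⇔ (fixed κ z ≡ c × fixed κ̄ z ≡ PL L)
  spread-line L (y , h) z = mk⇔ to from
    where
    PL≡ : PL L ≡ fixed κ̄ y
    PL≡ = Equivalence.to (T₂-block y (proj₁ L)) (proj₂ (Equivalence.to (h (proj₁ L)) (inj₁ refl)))
    to : OnLine z L → fixed κ z ≡ c × fixed κ̄ z ≡ PL L
    to o = Equivalence.to (T₁-block q z) (proj₁ (Equivalence.to (h z) o)) ,
           trans (Equivalence.to (T₂-block y z) (proj₂ (Equivalence.to (h z) o))) (sym PL≡)
    from : fixed κ z ≡ c × fixed κ̄ z ≡ PL L → OnLine z L
    from (e₁ , e₂) = Equivalence.from (h z)
      (Equivalence.from (T₁-block q z) e₁ , Equivalence.from (T₂-block y z) (trans e₂ PL≡))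

  c̄ : V2
  c̄ = fixed κ q̄

  c≢c̄ : c ≢ c̄
  c≢c̄ e = Q≢Q̄ (T₁-same q q̄ e)

  c̿ : V2
  c̿ = thirdPt c c̄

  Q̿-block : Q̿ ≐ Block κ c̿
  Q̿-block z = mk⇔ to from
    where
    to : Q̿ z → fixed κ z ≡ c̿
    to (x , xQ̄ , p , (_ , proj-out) , _ , refl-out) = third (proj-out x∉Q) (refl-out x∉Q)
      where
      ex = Equivalence.to (T₁-block q̄ x) xQ̄
      x∉Q : x ∉ Q
      x∉Q xQ = c≢c̄ (trans (sym (Equivalence.to (T₁-block q x) xQ)) ex)
      third : p ∈ Q × Collinear x p →
              z ≢ x × z ≢ p × Σ Line (λ L → OnLine x L × OnLine p L × OnLine z L) → fixed κ z ≡ c̿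
      third (pQ , x~p) (z≢x , z≢p , L , ox , op , oz) =
        trans (line-third κ L ox op oz (proj₁ x~p) z≢x z≢p)
              (cong negV (trans (cong₂ _+V_ ex (Equivalence.to (T₁-block q p) pQ)) (+V-comm c̄ c)))
    from : fixed κ z ≡ c̿ → Q̿ z
    from ez = by-progression (third-progression c c̄ c≢c̄)
      where
      fixed₁ : ∀ σ' → fixed κ (step (odir κ σ') z) ≡ c̿ +V slV σ'
      fixed₁ σ' = trans (fixed-ostep κ σ' z) (cong (_+V slV σ') ez)
      fixed₂ : ∀ σ' → fixed κ (step (odir κ σ') (step (odir κ σ') z)) ≡ c̿ +V slV σ' +V slV σ'
      fixed₂ σ' = trans (fixed-ostep κ σ' _) (cong (_+V slV σ') (fixed₁ σ'))
      -- z is the third point of a line through x ∈ Q̄ and p ∈ Q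
      reflected : ∀ {δ} x p → OnLine x (z , δ) → OnLine p (z , δ) →
                  fixed κ x ≡ c̄ → fixed κ p ≡ c → Q̿ z
      reflected {δ} x p ox op ex ep =
        x , Equivalence.from (T₁-block q̄ x) ex , p ,
        ((λ xQ → ⊥-elim (x∉Q xQ)) , λ _ → Equivalence.from (T₁-block q p) ep , x~p) ,
        (λ xQ → ⊥-elim (x∉Q xQ)) , λ _ → z≢x , z≢p , (z , δ) , ox , op , inj₁ refl
        where
        x∉Q : x ∉ Q
        x∉Q xQ = c≢c̄ (trans (sym (Equivalence.to (T₁-block q x) xQ)) ex)
        x~p : Collinear x p
        x~p = (λ e → c≢c̄ (trans (sym ep) (trans (cong (fixed κ) (sym e)) ex))) , (z , δ) , ox , op
        z≢x : z ≢ x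
        z≢x e = proj₂ (thirdPt-new c c̄ c≢c̄) (trans (sym ez) (trans (cong (fixed κ) e) ex))
        z≢p : z ≢ p
        z≢p e = proj₁ (thirdPt-new c c̄ c≢c̄) (trans (sym ez) (trans (cong (fixed κ) e) ep))
      by-progression : (Σ Slope λ σ' → (c̿ +V slV σ' ≡ c × c̿ +V slV σ' +V slV σ' ≡ c̄)
                                     ⊎ (c̿ +V slV σ' ≡ c̄ × c̿ +V slV σ' +V slV σ' ≡ c)) → Q̿ z
      by-progression (σ' , inj₁ (e₁ , e₂)) =
        reflected (pos z (odir κ σ') f2) (pos z (odir κ σ') f1) (inj₂ (inj₂ refl)) (inj₂ (inj₁ refl))
                  (trans (fixed₂ σ') e₂) (trans (fixed₁ σ') e₁)
      by-progression (σ' , inj₂ (e₁ , e₂)) =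
        reflected (pos z (odir κ σ') f1) (pos z (odir κ σ') f2) (inj₂ (inj₁ refl)) (inj₂ (inj₂ refl))
                  (trans (fixed₁ σ') e₁) (trans (fixed₂ σ') e₂)

  sℓ : Slope
  sℓ = proj₁ (lineThrough c c̄)

  oℓ : F3
  oℓ = proj₂ (lineThrough c c̄)

  cm : V2
  cm = fixed κ m

  cm-off : det cm (slV sℓ) ≢ oℓ
  cm-off on with Equivalence.to (lineThrough-points c c̄ c≢c̄ cm) on
  ... | inj₁ e        = Q₁≢Q (T₁-same m q e)
  ... | inj₂ (inj₁ e) = Q₁≢Q̄ (T₁-same m q̄ e)
  ... | inj₂ (inj₂ e) = Q₁≢Q̿ (≐-trans (T₁-block m) (≐-sym (λ z →
        subst (λ v → Q̿ z ⇔ (fixed κ z ≡ v)) (sym e) (Q̿-block z))))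

  cm≢c : cm ≢ c
  cm≢c e = cm-off (subst (λ u → det u (slV sℓ) ≡ oℓ) (sym e)
                         (Equivalence.from (lineThrough-points c c̄ c≢c̄ c) (inj₁ refl)))

  Ps : V2
  Ps = PL L*

  -- the candidates for W⁰ , W¹ , W² : the sets C j over the line, in R*
  C : F3 → Subset
  C j = lift κ̄ Ps (inC sℓ oℓ j)

  opaque
    C-W2 : ∀ j → IsW2Sub R* (C j)
    C-W2 j = (λ z zC → Equivalence.from (R-block L* z) (lift-fixed κ̄ Ps (inC sℓ oℓ j) z zC)) ,
             lift-GQ κ̄ Ps (inC sℓ oℓ j) 2 (C-nonempty sℓ oℓ j) (C-lines κ̄ sℓ oℓ j)

    -- the grid lies over the points c , c̄ , c̿ of the line
    C-grid : ∀ j z → Grid z → z ∈ C j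
    C-grid j z (zR* , zQ) = lift-intro κ̄ Ps (inC sℓ oℓ j) z (Equivalence.to (R-block L* z) zR*)
      (C-on-line sℓ oℓ j (moving κ̄ z) (level z)
        (Equivalence.from (lineThrough-points c c̄ c≢c̄ (moving κ̄ z))
          (subst (λ u → u ≡ c ⊎ u ≡ c̄ ⊎ u ≡ c̿) (sym (moving-other κ z)) (over zQ))))
      where
      over : z ∈ Q ⊎ z ∈ Q̄ ⊎ Q̿ z → fixed κ z ≡ c ⊎ fixed κ z ≡ c̄ ⊎ fixed κ z ≡ c̿
      over (inj₁ zQ)        = inj₁ (Equivalence.to (T₁-block q z) zQ)
      over (inj₂ (inj₁ zQ̄)) = inj₂ (inj₁ (Equivalence.to (T₁-block q̄ z) zQ̄))
      over (inj₂ (inj₂ zQ̿)) = inj₂ (inj₂ (Equivalence.to (Q̿-block z) zQ̿))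

    C-injective : ∀ j j' → ⟦ C j ⟧ ≐ ⟦ C j' ⟧ → j ≡ j'
    C-injective j j' h = C-distinct sℓ oℓ cm cm-off j j'
      (trans (sym (lift-emb κ̄ Ps (inC sℓ oℓ j') p)) (Equivalence.to (h (emb κ̄ Ps p))
             (trans (lift-emb κ̄ Ps (inC sℓ oℓ j) p) (C-graph sℓ oℓ j cm))))
      where
      p : Pl
      p = cm , Clevel sℓ oℓ cm ⊕ j

  -- each C j is one of the W i ; inverting,  W i = C (ρ i)  for a permutation ρ
  τ : F3 → F3
  τ j = proj₁ (W-all (C j) (C-W2 j) (C-grid j))

  C≐W : ∀ j → ⟦ C j ⟧ ≐ ⟦ W (τ j) ⟧
  C≐W j = proj₂ (W-all (C j) (C-W2 j) (C-grid j))

  τ-onto : ∀ i → Σ F3 λ j → τ j ≡ i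
  τ-onto i with cover (τ f0) (τ f1) (τ f2) (ne f0 f1 (λ ())) (ne f0 f2 (λ ())) (ne f1 f2 (λ ())) i
    where
    ne : ∀ j j' → j ≢ j' → τ j ≢ τ j'
    ne j j' n e = n (C-injective j j' (≐-trans (C≐W j)
                       (≐-sym (subst (λ i → ⟦ C j' ⟧ ≐ ⟦ W i ⟧) (sym e) (C≐W j')))))
  ... | inj₁ e        = f0 , sym e
  ... | inj₂ (inj₁ e) = f1 , sym e
  ... | inj₂ (inj₂ e) = f2 , sym e

  ρ : F3 → F3
  ρ i = proj₁ (τ-onto i)

  W≐C : ∀ i → ⟦ W i ⟧ ≐ ⟦ C (ρ i) ⟧
  W≐C i = subst (λ i' → ⟦ W i' ⟧ ≐ ⟦ C (ρ i) ⟧) (proj₂ (τ-onto i)) (≐-sym (C≐W (ρ i)))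

  ρ-injective : ∀ i i' → ρ i ≡ ρ i' → i ≡ i'
  ρ-injective i i' e = trans (sym (proj₂ (τ-onto i))) (trans (cong τ e) (proj₂ (τ-onto i')))

  -- ε is read off from levels, up to the constant E
  E : F3
  E = det c cm ⊖ Clevel sℓ oℓ cm

  -- for x on L* : the level of its neighbour u on M* determines ε x
  ε-on-L* : ∀ x e → OnLine x L* → IsEpsL x e → ρ e ≡ level x ⊕ E
  ε-on-L* x e ox (u , (_ , um) , x~u , uW) =
    trans (⊕-solve (level x ⊕ det c cm) (Clevel sℓ oℓ cm) (ρ e) (trans (sym level-u) on-graph))
          (⊕-assoc (level x) (det c cm) (⊝ Clevel sℓ oℓ cm))
    where
    fx : fixed κ x ≡ c
    fx = proj₁ (Equivalence.to (spread-line L* L*∈S x) ox)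
    fu : fixed κ u ≡ cm
    fu = Equivalence.to (T₁-block m u) um
    level-u : level u ≡ level x ⊕ det c cm
    level-u = trans (proj₂ (Equivalence.to (collinear-across κ x≢u) x~u))
                    (cong₂ (λ v v' → level x ⊕ det v v') fx fu)
      where x≢u = λ e' → cm≢c (trans (sym fu) (trans (sym e') fx))
    t-u : moving κ̄ u ≡ cm
    t-u = trans (moving-other κ u) fu
    on-graph : level u ≡ Clevel sℓ oℓ cm ⊕ ρ e
    on-graph = subst (λ t → level u ≡ Clevel sℓ oℓ t ⊕ ρ e) t-u
      (C-off-line sℓ oℓ (ρ e) (moving κ̄ u) (level u)
                  (λ on → cm-off (subst (λ t → det t (slV sℓ) ≡ oℓ) t-u on))
                  (lift-planar κ̄ Ps (inC sℓ oℓ (ρ e)) u (Equivalence.to (W≐C e u) uW)))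

  ε-formula : ∀ L → InS L → ∀ α e → OnLine α L → IsEps α e → ρ e ≡ (level α ⊕ det (PL L) Ps) ⊕ E
  ε-formula L L∈S α e oα (inj₁ (o* , ε-α)) =
    trans (ε-on-L* α e o* ε-α)
          (cong (_⊕ E) (sym (trans (cong (level α ⊕_) (trans (cong (λ v → det v Ps) PL≡) (det-self Ps)))
                                   (⊕-identityʳ (level α)))))
    where
    PL≡ : PL L ≡ Ps
    PL≡ = trans (sym (proj₂ (Equivalence.to (spread-line L L∈S α) oα)))
                (proj₂ (Equivalence.to (spread-line L* L*∈S α) o*))
  ε-formula L L∈S α e oα (inj₂ (α∉L* , x , ox , α~x , ε-x)) =
    trans (ε-on-L* x e ox ε-x) (cong (_⊕ E) level-x)
    where
    fα = Equivalence.to (spread-line L L∈S α) oα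
    fx = Equivalence.to (spread-line L* L*∈S x) ox
    off-L* : fixed κ̄ α ≢ fixed κ̄ x
    off-L* e' = α∉L* (Equivalence.from (spread-line L* L*∈S α) (proj₁ fα , trans e' (proj₂ fx)))
    level-x : level x ≡ level α ⊕ det (PL L) Ps
    level-x = trans (proj₂ (Equivalence.to (collinear-across κ̄ off-L*) α~x))
                    (cong₂ (λ v v' → level α ⊕ det v v') (proj₂ fα) (proj₂ fx))

  -- π_{R*} ∘ π_{R_{L₂}} ∘ π_{R_{L₁}}  shifts the levels of R* by δθ
  Φ : Line → Line → Point → Point
  Φ L₁ L₂ w = proj κ̄ Ps (proj κ̄ (PL L₂) (proj κ̄ (PL L₁) w))

  δθ : Line → Line → F3
  δθ L₁ L₂ = (det Ps (PL L₁) ⊕ det (PL L₁) (PL L₂)) ⊕ det (PL L₂) Ps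

  Φ-emb : ∀ L₁ L₂ t a → Φ L₁ L₂ (emb κ̄ Ps (t , a)) ≡ emb κ̄ Ps (t , a ⊕ δθ L₁ L₂)
  Φ-emb L₁ L₂ t a = begin
    proj κ̄ Ps (proj κ̄ (PL L₂) (proj κ̄ (PL L₁) (emb κ̄ Ps (t , a))))
      ≡⟨ cong (λ w → proj κ̄ Ps (proj κ̄ (PL L₂) w)) (proj-emb κ̄ Ps (PL L₁) (t , a)) ⟩
    proj κ̄ Ps (proj κ̄ (PL L₂) (emb κ̄ (PL L₁) (t , a ⊕ det Ps (PL L₁))))
      ≡⟨ cong (proj κ̄ Ps) (proj-emb κ̄ (PL L₁) (PL L₂) _) ⟩
    proj κ̄ Ps (emb κ̄ (PL L₂) (t , (a ⊕ det Ps (PL L₁)) ⊕ det (PL L₁) (PL L₂)))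
      ≡⟨ proj-emb κ̄ (PL L₂) Ps _ ⟩
    emb κ̄ Ps (t , ((a ⊕ det Ps (PL L₁)) ⊕ det (PL L₁) (PL L₂)) ⊕ det (PL L₂) Ps)
      ≡⟨ cong (λ a' → emb κ̄ Ps (t , a')) (⊕-assoc³ a _ _ _) ⟩
    emb κ̄ Ps (t , a ⊕ δθ L₁ L₂) ∎
    where open ≡-Reasoning

  Img≐C : ∀ L₁ L₂ i → Img L₁ L₂ i ≐ ⟦ C (ρ i ⊕ δθ L₁ L₂) ⟧
  Img≐C L₁ L₂ i y = mk⇔ to from
    where
    d = δθ L₁ L₂
    projects : ∀ L {w u} → IsProj (R_ L) w u ⇔ u ≡ proj κ̄ (PL L) w
    projects L {w} {u} = proj-spec κ̄ (PL L) (R-block L) w u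
    to : Img L₁ L₂ i y → y ∈ C (ρ i ⊕ d)
    to (w , u , v , wW , p₁ , p₂ , p₃) = subst (_∈ C (ρ i ⊕ d)) (sym y≡)
        (trans (lift-emb κ̄ Ps (inC sℓ oℓ (ρ i ⊕ d)) _)
        (trans (C-shift sℓ oℓ (ρ i) d (moving κ̄ w) (level w))
               (lift-planar κ̄ Ps (inC sℓ oℓ (ρ i)) w wC)))
      where
      wC = Equivalence.to (W≐C i w) wW
      y≡ : y ≡ emb κ̄ Ps (moving κ̄ w , level w ⊕ d)
      y≡ = trans (Equivalence.to (projects L*) p₃)
           (trans (cong (proj κ̄ Ps) (Equivalence.to (projects L₂) p₂))
           (trans (cong (λ u' → proj κ̄ Ps (proj κ̄ (PL L₂) u')) (Equivalence.to (projects L₁) p₁))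
           (trans (cong (Φ L₁ L₂) (lift-point κ̄ Ps (inC sℓ oℓ (ρ i)) w wC))
                  (Φ-emb L₁ L₂ (moving κ̄ w) (level w)))))
    from : y ∈ C (ρ i ⊕ d) → Img L₁ L₂ i y
    from yC = w , u , v , Equivalence.from (W≐C i w) wC ,
              Equivalence.from (projects L₁) refl , Equivalence.from (projects L₂) refl ,
              Equivalence.from (projects L*) (sym Φw≡y)
      where
      t = moving κ̄ y
      a = level y
      w = emb κ̄ Ps (t , a ⊖ d)
      u = proj κ̄ (PL L₁) w
      v = proj κ̄ (PL L₂) u
      wC : w ∈ C (ρ i)
      wC = trans (lift-emb κ̄ Ps (inC sℓ oℓ (ρ i)) _)
           (trans (sym (C-shift sℓ oℓ (ρ i) d t (a ⊖ d)))
           (trans (cong (λ a' → inC sℓ oℓ (ρ i ⊕ d) (t , a')) (⊖-⊕ a d))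
                  (lift-planar κ̄ Ps (inC sℓ oℓ (ρ i ⊕ d)) y yC)))
      Φw≡y : Φ L₁ L₂ w ≡ y
      Φw≡y = trans (Φ-emb L₁ L₂ t (a ⊖ d))
             (trans (cong (λ a' → emb κ̄ Ps (t , a')) (⊖-⊕ a d))
                    (sym (lift-point κ̄ Ps (inC sℓ oℓ (ρ i ⊕ d)) y yC)))

  theta-spec : ∀ L₁ L₂ t → IsTheta L₁ L₂ t ⇔ (∀ i → ρ i ⊕ δθ L₁ L₂ ≡ ρ (i ⊕ t))
  theta-spec L₁ L₂ t = mk⇔
    (λ h i → C-injective _ _ (≐-trans (≐-sym (Img≐C L₁ L₂ i)) (≐-trans (h i) (W≐C (i ⊕ t)))))
    (λ h i → ≐-trans (Img≐C L₁ L₂ i)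
               (subst (λ j → ⟦ C j ⟧ ≐ ⟦ W (i ⊕ t) ⟧) (sym (h i)) (≐-sym (W≐C (i ⊕ t)))))

  collinear-spread : ∀ L₁ L₂ → InS L₁ → InS L₂ → ¬ SameLine L₁ L₂ →
                     ∀ α₁ α₂ → OnLine α₁ L₁ → OnLine α₂ L₂ →
                     Collinear α₁ α₂ ⇔ (level α₂ ≡ level α₁ ⊕ det (PL L₁) (PL L₂))
  collinear-spread L₁ L₂ L₁∈S L₂∈S L₁≢L₂ α₁ α₂ o₁ o₂ = mk⇔
    (λ col → trans (proj₂ (Equivalence.to criterion col))
                   (cong₂ (λ v v' → level α₁ ⊕ det v v') (proj₂ f₁) (proj₂ f₂)))
    (λ e → Equivalence.from criterion
      (trans (moving-other κ α₁) (trans (proj₁ f₁) (sym (trans (moving-other κ α₂) (proj₁ f₂)))) ,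
       trans e (cong₂ (λ v v' → level α₁ ⊕ det v v') (sym (proj₂ f₁)) (sym (proj₂ f₂)))))
    where
    f₁ = Equivalence.to (spread-line L₁ L₁∈S α₁) o₁
    f₂ = Equivalence.to (spread-line L₂ L₂∈S α₂) o₂
    swap : ∀ {L L'} → InS L → InS L' → PL L ≡ PL L' → ∀ z → OnLine z L → OnLine z L'
    swap {L} {L'} L∈S L'∈S e z o = Equivalence.from (spread-line L' L'∈S z)
      (proj₁ (Equivalence.to (spread-line L L∈S z) o) , trans (proj₂ (Equivalence.to (spread-line L L∈S z) o)) e)
    P≢ : PL L₁ ≢ PL L₂
    P≢ e = L₁≢L₂ λ z → mk⇔ (swap L₁∈S L₂∈S e z) (swap L₂∈S L₁∈S (sym e) z)
    criterion = collinear-across κ̄ (λ e → P≢ (trans (sym (proj₂ f₁)) (trans e (proj₂ f₂))))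

≡⇔≡ : ∀ {a a' b b' : F3} → a ≡ a' → b ≡ b' → (a ≡ b) ⇔ (a' ≡ b')
≡⇔≡ refl refl = mk⇔ (λ e → e) (λ e → e)

lemma5p1 : (σ : Setting) → let open Setting σ in
    (L₁ L₂ : Line) → InS L₁ → InS L₂ → ¬ SameLine L₁ L₂ →
    (α₁ α₂ : Point) → OnLine α₁ L₁ → OnLine α₂ L₂ →
    (e₁ e₂ : F3) → IsEps α₁ e₁ → IsEps α₂ e₂ →
    (Collinear α₁ α₂ ⇔ IsTheta L₁ L₂ (e₂ ⊖ e₁))
lemma5p1 σ L₁ L₂ L₁∈S L₂∈S L₁≢L₂ α₁ α₂ o₁ o₂ e₁ e₂ ε₁ ε₂ = begin
  Collinear α₁ α₂
    ∼⟨ collinear-spread L₁ L₂ L₁∈S L₂∈S L₁≢L₂ α₁ α₂ o₁ o₂ ⟩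
  (level α₂ ≡ level α₁ ⊕ det P₁ P₂)
    ∼⟨ level-algebra (level α₁) (level α₂) (det P₁ Ps) (det P₁ P₂) (det P₂ Ps) E ⟩
  ((⊝ det P₁ Ps) ⊕ det P₁ P₂) ⊕ det P₂ Ps ≡ ((level α₂ ⊕ det P₂ Ps) ⊕ E) ⊖ ((level α₁ ⊕ det P₁ Ps) ⊕ E)
    ∼⟨ ≡⇔≡ (cong (λ x → (x ⊕ det P₁ P₂) ⊕ det P₂ Ps) (sym (det-anti Ps P₁)))
           (sym (cong₂ _⊖_ (ε-formula L₂ L₂∈S α₂ e₂ o₂ ε₂) (ε-formula L₁ L₁∈S α₁ e₁ o₁ ε₁))) ⟩
  (δθ L₁ L₂ ≡ ρ e₂ ⊖ ρ e₁)
    ∼⟨ ⇔-sym (shift-criterion ρ ρ-injective e₁ e₂ (δθ L₁ L₂)) ⟩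
  (∀ i → ρ i ⊕ δθ L₁ L₂ ≡ ρ (i ⊕ (e₂ ⊖ e₁)))
    ∼⟨ ⇔-sym (theta-spec L₁ L₂ (e₂ ⊖ e₁)) ⟩
  IsTheta L₁ L₂ (e₂ ⊖ e₁) ∎
  where
  open Setting σ
  open InSetting σ
  open EquationalReasoning
  P₁ = PL L₁
  P₂ = PL L₂
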